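{- Let $k,t$ be positive integers and let $n\geq \max\{12tk+2k,\,4tk^2\}$. Then $$r(K_{1,n-1},tF_k)=2n+t-2.$$
   Context: All graphs are finite and simple. For graphs $G$ and $H$, the Ramsey number $r(G,H)$ is the smallest positive integer $N$ such that every red-blue coloring of the edges of $K_N$ contains a red subgraph isomorphic to $G$ or a blue subgraph isomorphic to $H$. $K_{1,n-1}$ is the star with $n$ vertices. The fan $F_k$ is the graph consisting of $k$ triangles sharing one common vertex ($F_k=K_1+kK_2$), and $tF_k$ denotes the disjoint union of $t$ vertex-disjoint copies of $F_k$. -}

module Defs where

open import Data.Nat using (ℕ; zero; suc; _+_; _*_; _∸_; _<_; _≤_; _⊔_; ⌊_/2⌋)
open import Data.Fin using (Fin; toℕ)
open import Data.Bool using (Bool; true; false)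
open import Data.Product using (_×_; Σ; proj₁; proj₂)
open import Data.Sum using (_⊎_)
open import Relation.Nullary using (¬_)
open import Relation.Binary.PropositionalEquality using (_≡_; _≢_)
open import Function.Definitions using (Injective)

record Graph : Set₁ where
  field
    V   : Set
    Adj : V → V → Set
open Graph public

Colour : Set
Colour = Bool

red blue : Colour
red = true
blue = false

-- A red/blue colouring of the edges of K_N (symmetric; the diagonal is irrelevant).
record Colouring (N : ℕ) : Set where
  field
    col  : Fin N → Fin N → Colour
    symm : ∀ i j → col i j ≡ col j i
open Colouring public

HasMono : ∀ {N} → Colouring N → Colour → Graph → Set
HasMono {N} c κ G =
  Σ (V G → Fin N) λ f → Injective _≡_ _≡_ f × (∀ u v → Adj G u v → col c (f u) (f v) ≡ κ)

Arrows : Graph → Graph → ℕ → Set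
Arrows G H N = (c : Colouring N) → HasMono c red G ⊎ HasMono c blue H

IsRamseyNumber : Graph → Graph → ℕ → Set
IsRamseyNumber G H N =
  0 < N × Arrows G H N × (∀ M → 0 < M → M < N → ¬ Arrows G H M)

Star : ℕ → Graph
Star n = record
  { V = Fin n
  ; Adj = λ i j → (toℕ i ≡ 0 × toℕ j ≢ 0) ⊎ (toℕ j ≡ 0 × toℕ i ≢ 0)
  }

-- Adjacency in the fan F_k on {0,…,2k}: centre 0, triangles {0, 2i+1, 2i+2}.
FanAdj : ℕ → ℕ → Set
FanAdj a b =
  (a ≡ 0 × b ≢ 0) ⊎ (b ≡ 0 × a ≢ 0)
  ⊎ (a ≢ 0 × b ≢ 0 × a ≢ b × ⌊ a ∸ 1 /2⌋ ≡ ⌊ b ∸ 1 /2⌋)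

tFan : ℕ → ℕ → Graph
tFan t k = record
  { V = Fin t × Fin (suc (2 * k))
  ; Adj = λ u v → proj₁ u ≡ proj₁ v × FanAdj (toℕ (proj₂ u)) (toℕ (proj₂ v))
  }

-- Lower bound: split 2n + t - 3 vertices into t - 1 apex vertices and two sides of n - 1
-- vertices, and colour an edge red exactly when it lies inside a side.  Every red degree is
-- at most n - 2, and every blue triangle contains an apex vertex, so t disjoint blue fans
-- would need t apex vertices.
--
-- Upper bound: with N = 2n + t - 2 and no red K_{1,n-1}, every blue degree is at least
-- n + t - 1.  Fans are built greedily: a centre v plus a greedy blue matching of size k in
-- the unused part of its blue neighbourhood.  When the matching gets stuck, the rest of that
-- neighbourhood is a red clique I of size at least n + 2 - 2tk.  Searching again with centres
-- in I either succeeds or produces a second red clique J, disjoint from I because the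
-- centre is red to I and blue to J.  The remaining t + β + γ vertices (β, γ the slacks
-- n - 1 - |I|, n - 1 - |J|) each have n - β - γ blue neighbours in I ∪ J, hence many in J
-- or many in I; the final fans are centred there, with each blade joining I to J.

module Submission where

open import Defs
open import Level using (Level; 0ℓ)
open import Data.Bool using (true; false) renaming (_≟_ to _≟ᵇ_)
open import Data.Fin using (Fin; zero; suc; toℕ; fromℕ<; inject≤; splitAt; join; remQuot; combine)
open import Data.Fin.Properties using (_≟_; any?; toℕ<n; toℕ-injective; inject≤-injective; join-splitAt; combine-remQuot; toℕ-fromℕ<; injective⇒≤)
import Data.Fin.Properties as Finₚ
open import Data.List using (List; []; _∷_; _++_; length)
open import Data.List.Properties using (length-++)
open import Data.List.Membership.Propositional using () renaming (_∈_ to _∈ˡ_; _∉_ to _∉ˡ_)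
open import Data.List.Membership.Propositional.Properties using (∈-++⁺ˡ; ∈-++⁺ʳ; ∈-++⁻)
open import Data.List.Relation.Unary.Any using (here; there)
import Data.List.Relation.Unary.All as Allˡ
open import Data.List.Relation.Unary.All.Properties using (¬Any⇒All¬)
open import Data.List.Relation.Unary.Unique.Propositional using (Unique; []; _∷_)
open import Data.Nat using (ℕ; zero; suc; _+_; _*_; _∸_; _≤_; _<_; _⊔_; z≤n; s≤s; _≤?_; ⌊_/2⌋)
open import Data.Nat.Properties hiding (_≟_)
open import Data.Nat.Tactic.RingSolver using (solve-∀)
open import Data.Product using (Σ; ∃; ∃₂; _×_; _,_; proj₁; proj₂; uncurry)
open import Data.Sum using (_⊎_; inj₁; inj₂)
import Data.Sum as Sum
open import Data.Sum.Properties using (inj₂-injective)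
open import Data.Unit using (tt)
open import Data.Vec using (Vec; []; _∷_)
import Data.Vec.Relation.Unary.All as Allᵛ
open import Function using (_∘_)
open import Function.Definitions using (Injective)
open import Relation.Binary.PropositionalEquality using (_≡_; _≢_; refl; sym; trans; cong; cong₂; subst; subst₂; module ≡-Reasoning)
open import Relation.Nullary using (¬_; Dec; yes; no; does; _×-dec_; ¬?; contradiction)
open import Relation.Unary using (Pred; Decidable; _∈_; _∉_; _⊆_; _∩_; _∪_; _∖_; _≐_; U; ⋃)
open import Relation.Unary.Properties using (_∩?_; _∪?_; ∁?; U?)

module _ {A : Set} where

  nth : A → List A → ℕ → A
  nth d []       _       = d
  nth d (x ∷ xs) zero    = x
  nth d (x ∷ xs) (suc a) = nth d xs a

  nth-∈ : ∀ d xs {a} → a < length xs → nth d xs a ∈ˡ xs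
  nth-∈ d (x ∷ xs) {zero}  _         = here refl
  nth-∈ d (x ∷ xs) {suc a} (s≤s a<n) = there (nth-∈ d xs a<n)

  nth-injective : ∀ d {xs a b} → Unique xs → a < length xs → b < length xs → nth d xs a ≡ nth d xs b → a ≡ b
  nth-injective d {x ∷ xs} {zero}  {zero}  _          _         _         _ = refl
  nth-injective d {x ∷ xs} {zero}  {suc b} (x∉ ∷ _)   _         (s≤s b<n) e = contradiction e (Allˡ.lookup x∉ (nth-∈ d xs b<n))
  nth-injective d {x ∷ xs} {suc a} {zero}  (x∉ ∷ _)   (s≤s a<n) _         e = contradiction (sym e) (Allˡ.lookup x∉ (nth-∈ d xs a<n))
  nth-injective d {x ∷ xs} {suc a} {suc b} (_ ∷ uniq) (s≤s a<n) (s≤s b<n) e = cong suc (nth-injective d uniq a<n b<n e)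

  flat : ∀ {k} → Vec (A × A) k → List A
  flat []             = []
  flat ((x , y) ∷ ps) = x ∷ y ∷ flat ps

  length-flat : ∀ {k} (ps : Vec (A × A) k) → length (flat ps) ≡ 2 * k
  length-flat []             = refl
  length-flat {suc k} (_ ∷ ps) = cong suc (trans (cong suc (length-flat ps)) (sym (+-suc k (k + 0))))

  nth-flat-pair : ∀ {k} (P : A → A → Set) → (∀ {x y} → P x y → P y x) → (ps : Vec (A × A) k) → Allᵛ.All (λ (x , y) → P x y) ps →
                  ∀ d {a b} → a < 2 * k → b < 2 * k → a ≢ b → ⌊ a /2⌋ ≡ ⌊ b /2⌋ → P (nth d (flat ps) a) (nth d (flat ps) b)
  nth-flat-pair P P-sym ((x , y) ∷ ps) (pxy Allᵛ.∷ _) d {0} {1} _ _ _ _ = pxy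
  nth-flat-pair P P-sym ((x , y) ∷ ps) (pxy Allᵛ.∷ _) d {1} {0} _ _ _ _ = P-sym pxy
  nth-flat-pair P P-sym ((x , y) ∷ ps) _ d {0} {0} _ _ a≢b _ = contradiction refl a≢b
  nth-flat-pair P P-sym ((x , y) ∷ ps) _ d {1} {1} _ _ a≢b _ = contradiction refl a≢b
  nth-flat-pair {suc k} P P-sym ((x , y) ∷ ps) (_ Allᵛ.∷ pps) d {suc (suc a)} {suc (suc b)} a< b< a≢b e =
    nth-flat-pair P P-sym ps pps d (shrink a<) (shrink b<) (λ a≡b → a≢b (cong (2 +_) a≡b)) (suc-injective e)
    where
    shrink : ∀ {a} → suc (suc a) < 2 * suc k → a < 2 * k
    shrink {a} h = ≤-pred (≤-pred (subst (suc (suc (suc a)) ≤_) (cong suc (+-suc k (k + 0))) h))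

-- Counting decidable sets of vertices

private variable
  ℓ ℓ₁ ℓ₂ : Level

count : ∀ {N} {P : Pred (Fin N) ℓ} → Decidable P → ℕ
count {N = zero}  P? = 0
count {N = suc N} P? with P? zero
... | yes _ = suc (count (P? ∘ suc))
... | no  _ = count (P? ∘ suc)

infixr 6 _∖?_

_∖?_ : ∀ {N} {P : Pred (Fin N) ℓ₁} {Q : Pred (Fin N) ℓ₂} → Decidable P → Decidable Q → Decidable (P ∖ Q)
P? ∖? Q? = P? ∩? ∁? Q?

count-mono : ∀ {N} {P : Pred (Fin N) ℓ₁} {Q : Pred (Fin N) ℓ₂} (P? : Decidable P) (Q? : Decidable Q) →
             P ⊆ Q → count P? ≤ count Q?
count-mono {N = zero}  P? Q? P⊆Q = z≤n
count-mono {N = suc N} P? Q? P⊆Q with P? zero | Q? zero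
... | yes _  | yes _  = s≤s (count-mono (P? ∘ suc) (Q? ∘ suc) P⊆Q)
... | yes p  | no ¬q  = contradiction (P⊆Q p) ¬q
... | no _   | yes _  = m≤n⇒m≤1+n (count-mono (P? ∘ suc) (Q? ∘ suc) P⊆Q)
... | no _   | no _   = count-mono (P? ∘ suc) (Q? ∘ suc) P⊆Q

count-cong : ∀ {N} {P : Pred (Fin N) ℓ₁} {Q : Pred (Fin N) ℓ₂} (P? : Decidable P) (Q? : Decidable Q) →
             P ≐ Q → count P? ≡ count Q?
count-cong P? Q? (P⊆Q , Q⊆P) = ≤-antisym (count-mono P? Q? P⊆Q) (count-mono Q? P? Q⊆P)

count-split : ∀ {N} {P : Pred (Fin N) ℓ₁} {Q : Pred (Fin N) ℓ₂} (P? : Decidable P) (Q? : Decidable Q) →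
              count P? ≡ count (P? ∩? Q?) + count (P? ∖? Q?)
count-split {N = zero}  P? Q? = refl
count-split {N = suc N} P? Q? with P? zero | Q? zero
... | yes _ | yes _ = cong suc (count-split (P? ∘ suc) (Q? ∘ suc))
... | yes _ | no  _ = trans (cong suc (count-split (P? ∘ suc) (Q? ∘ suc))) (sym (+-suc _ _))
... | no  _ | yes _ = count-split (P? ∘ suc) (Q? ∘ suc)
... | no  _ | no  _ = count-split (P? ∘ suc) (Q? ∘ suc)

count-∪ : ∀ {N} {P : Pred (Fin N) ℓ₁} {Q : Pred (Fin N) ℓ₂} (P? : Decidable P) (Q? : Decidable Q) →
          count (P? ∪? Q?) ≤ count P? + count Q?
count-∪ {N = zero}  P? Q? = z≤n
count-∪ {N = suc N} P? Q? with P? zero | Q? zero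
... | yes _ | yes _ = s≤s (≤-trans (count-∪ (P? ∘ suc) (Q? ∘ suc)) (+-monoʳ-≤ (count (P? ∘ suc)) (n≤1+n _)))
... | yes _ | no  _ = s≤s (count-∪ (P? ∘ suc) (Q? ∘ suc))
... | no  _ | yes _ = ≤-trans (s≤s (count-∪ (P? ∘ suc) (Q? ∘ suc))) (≤-reflexive (sym (+-suc _ _)))
... | no  _ | no  _ = count-∪ (P? ∘ suc) (Q? ∘ suc)

count-U : ∀ {N} → count (U? {A = Fin N}) ≡ N
count-U {zero}  = refl
count-U {suc N} = cong suc count-U

count-empty : ∀ {N} {P : Pred (Fin N) ℓ} (P? : Decidable P) → (∀ {u} → u ∉ P) → count P? ≡ 0
count-empty {N = zero}  P? ∅ = refl
count-empty {N = suc N} P? ∅ with P? zero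
... | yes p = contradiction p ∅
... | no  _ = count-empty (P? ∘ suc) ∅

count-≡ : ∀ {N} (v : Fin N) → count (_≟ v) ≡ 1
count-≡ {suc N} zero    = cong suc (count-empty {N = N} (λ u → suc u ≟ zero) λ ())
count-≡ {suc N} (suc v) = trans (count-cong (λ u → suc u ≟ suc v) (_≟ v) (Finₚ.suc-injective , cong suc)) (count-≡ v)

count>0⇒nonempty : ∀ {N} {P : Pred (Fin N) ℓ} (P? : Decidable P) → 0 < count P? → ∃ P
count>0⇒nonempty {N = suc N} P? pos with P? zero
... | yes p = zero , p
... | no  _ = let (u , pu) = count>0⇒nonempty (P? ∘ suc) pos in suc u , pu

count-remove : ∀ {N} {P : Pred (Fin N) ℓ} (P? : Decidable P) {x : Fin N} → x ∈ P →
               count P? ≡ suc (count (P? ∖? (_≟ x)))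
count-remove {P = P} P? {x} x∈P = begin
  count P?                                      ≡⟨ count-split P? (_≟ x) ⟩
  count (P? ∩? (_≟ x)) + count (P? ∖? (_≟ x))   ≡⟨ cong (_+ count (P? ∖? (_≟ x))) (trans (count-cong _ (_≟ x) ≐≡x) (count-≡ x)) ⟩
  suc (count (P? ∖? (_≟ x)))                    ∎
  where
  open ≡-Reasoning
  ≐≡x : (P ∩ (_≡ x)) ≐ (_≡ x)
  ≐≡x = proj₂ , λ { refl → x∈P , refl }

record _↪_ {N} (m : ℕ) (P : Pred (Fin N) ℓ) : Set ℓ where
  field
    elem           : Fin m → Fin N
    elem-injective : Injective _≡_ _≡_ elem
    elem∈          : ∀ i → elem i ∈ P
open _↪_ public

pickDistinct : ∀ {N} {P : Pred (Fin N) ℓ} (P? : Decidable P) m → m ≤ count P? → m ↪ P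
pickDistinct P? zero    _ = record { elem = λ () ; elem-injective = λ {} ; elem∈ = λ () }
pickDistinct {N = N} {P = P} P? (suc m) m<count with count>0⇒nonempty P? (≤-trans (s≤s z≤n) m<count)
... | x , x∈P = record { elem = elem′ ; elem-injective = inj ; elem∈ = elem′∈ }
  where
  rest : m ↪ (P ∖ (_≡ x))
  rest = pickDistinct (P? ∖? (_≟ x)) m (≤-pred (≤-trans m<count (≤-reflexive (count-remove P? x∈P))))
  elem′ : Fin (suc m) → Fin N
  elem′ zero    = x
  elem′ (suc i) = elem rest i
  elem′∈ : ∀ i → elem′ i ∈ P
  elem′∈ zero    = x∈P
  elem′∈ (suc i) = proj₁ (elem∈ rest i)
  inj : Injective _≡_ _≡_ elem′
  inj {zero}  {zero}  _ = refl
  inj {zero}  {suc j} e = contradiction (sym e) (proj₂ (elem∈ rest j))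
  inj {suc i} {zero}  e = contradiction e (proj₂ (elem∈ rest i))
  inj {suc i} {suc j} e = cong suc (elem-injective rest e)

↪⇒≤count : ∀ {N} {P : Pred (Fin N) ℓ} (P? : Decidable P) {m} → m ↪ P → m ≤ count P?
↪⇒≤count P? {zero}  _ = z≤n
↪⇒≤count {P = P} P? {suc m} e = begin
  suc m                        ≤⟨ s≤s (↪⇒≤count (P? ∖? (_≟ x)) rest) ⟩
  suc (count (P? ∖? (_≟ x)))   ≡⟨ count-remove P? (elem∈ e zero) ⟨
  count P?                     ∎
  where
  open ≤-Reasoning
  x : Fin _
  x = elem e zero
  rest : m ↪ (P ∖ (_≡ x))
  rest = record
    { elem           = elem e ∘ suc
    ; elem-injective = λ eq → Finₚ.suc-injective (elem-injective e eq)
    ; elem∈          = λ i → elem∈ e (suc i) , λ eq → contradiction (elem-injective e eq) λ ()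
    }

count-⋃ : ∀ {N m b} {P : Fin m → Pred (Fin N) ℓ} (P? : ∀ i → Decidable (P i)) →
          (∀ i → count (P? i) < b) → count (λ x → any? (λ i → P? i x)) + m ≤ m * b
count-⋃ {m = zero} P? _ = ≤-reflexive (cong (_+ 0) (count-empty (λ x → any? (λ i → P? i x)) λ { (() , _) }))
count-⋃ {N = N} {m = suc m} {b} {P} P? small = begin
  count ⋃? + suc m                                  ≤⟨ +-monoˡ-≤ (suc m) (count-mono ⋃? (P? zero ∪? ⋃rest?) split) ⟩
  count (P? zero ∪? ⋃rest?) + suc m                  ≤⟨ +-monoˡ-≤ (suc m) (count-∪ (P? zero) ⋃rest?) ⟩
  count (P? zero) + count ⋃rest? + suc m              ≡⟨ shuffle (count (P? zero)) (count ⋃rest?) m ⟩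
  suc (count (P? zero)) + (count ⋃rest? + m)          ≤⟨ +-mono-≤ (small zero) (count-⋃ (P? ∘ suc) (small ∘ suc)) ⟩
  b + m * b                                          ∎
  where
  open ≤-Reasoning
  ⋃? : Decidable (⋃ (Fin (suc m)) P)
  ⋃? x = any? (λ i → P? i x)
  ⋃rest? : Decidable (⋃ (Fin m) (P ∘ suc))
  ⋃rest? x = any? (λ i → P? (suc i) x)
  split : ⋃ (Fin (suc m)) P ⊆ P zero ∪ ⋃ (Fin m) (P ∘ suc)
  split (zero  , p) = inj₁ p
  split (suc i , p) = inj₂ (i , p)
  shuffle : ∀ a r m → a + r + suc m ≡ suc a + (r + m)
  shuffle a r m = trans (+-suc (a + r) m) (cong suc (+-assoc a r m))

count-∖ : ∀ {N} {P : Pred (Fin N) ℓ₁} {Q : Pred (Fin N) ℓ₂} (P? : Decidable P) (Q? : Decidable Q) {b} →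
          count (P? ∩? Q?) ≤ b → count P? ≤ b + count (P? ∖? Q?)
count-∖ P? Q? {b} P∩Q≤b = ≤-trans (≤-reflexive (count-split P? Q?)) (+-monoˡ-≤ (count (P? ∖? Q?)) P∩Q≤b)

module _ {N : ℕ} where

  open import Data.List.Membership.DecPropositional (_≟_ {N}) using () renaming (_∈?_ to _∈ˡ?_)

  count-∈ : (L : List (Fin N)) → count (_∈ˡ? L) ≤ length L
  count-∈ []      = ≤-reflexive (count-empty (_∈ˡ? []) λ ())
  count-∈ (x ∷ L) = begin
    count (_∈ˡ? (x ∷ L))               ≤⟨ count-mono (_∈ˡ? (x ∷ L)) ((_≟ x) ∪? (_∈ˡ? L)) here-or-there ⟩
    count ((_≟ x) ∪? (_∈ˡ? L))         ≤⟨ count-∪ (_≟ x) (_∈ˡ? L) ⟩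
    count (_≟ x) + count (_∈ˡ? L)      ≤⟨ +-mono-≤ (≤-reflexive (count-≡ x)) (count-∈ L) ⟩
    suc (length L)                    ∎
    where
    open ≤-Reasoning
    here-or-there : (_∈ˡ (x ∷ L)) ⊆ ((_≡ x) ∪ (_∈ˡ L))
    here-or-there (here p)  = inj₁ p
    here-or-there (there p) = inj₂ p

  count-∩-++ : ∀ {Z : Pred (Fin N) 0ℓ} (Z? : Decidable Z) (A B : List (Fin N)) →
               count (Z? ∩? (_∈ˡ? (A ++ B))) ≤ count (Z? ∩? (_∈ˡ? A)) + count (Z? ∩? (_∈ˡ? B))
  count-∩-++ {Z} Z? A B =
    ≤-trans (count-mono _ ((Z? ∩? (_∈ˡ? A)) ∪? (Z? ∩? (_∈ˡ? B))) split) (count-∪ (Z? ∩? (_∈ˡ? A)) (Z? ∩? (_∈ˡ? B)))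
    where
    split : ∀ {u} → u ∈ Z × u ∈ˡ (A ++ B) → u ∈ Z × u ∈ˡ A ⊎ u ∈ Z × u ∈ˡ B
    split (z , u∈) with ∈-++⁻ A u∈
    ... | inj₁ u∈A = inj₁ (z , u∈A)
    ... | inj₂ u∈B = inj₂ (z , u∈B)

  count-∩-flat : ∀ {Z : Pred (Fin N) 0ℓ} (Z? : Decidable Z) {k} (ps : Vec (Fin N × Fin N) k) →
                 Allᵛ.All (λ (x , y) → x ∉ Z ⊎ y ∉ Z) ps → count (Z? ∩? (_∈ˡ? flat ps)) ≤ k
  count-∩-flat Z? [] _ = ≤-reflexive (count-empty (Z? ∩? (_∈ˡ? [])) λ ())
  count-∩-flat {Z} Z? {suc k} ((x , y) ∷ ps) (one Allᵛ.∷ rest) = begin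
    count (Z? ∩? (_∈ˡ? (x ∷ y ∷ flat ps)))        ≤⟨ count-mono _ ((_≟ w) ∪? (Z? ∩? (_∈ˡ? flat ps))) (cover one) ⟩
    count ((_≟ w) ∪? (Z? ∩? (_∈ˡ? flat ps)))      ≤⟨ count-∪ (_≟ w) _ ⟩
    count (_≟ w) + count (Z? ∩? (_∈ˡ? flat ps))   ≤⟨ +-mono-≤ (≤-reflexive (count-≡ w)) (count-∩-flat Z? ps rest) ⟩
    suc k                                         ∎
    where
    open ≤-Reasoning
    endpoint : x ∉ Z ⊎ y ∉ Z → Fin N
    endpoint (inj₁ _) = y
    endpoint (inj₂ _) = x
    w : Fin N
    w = endpoint one
    cover : ∀ o → Z ∩ (_∈ˡ (x ∷ y ∷ flat ps)) ⊆ (_≡ endpoint o) ∪ (Z ∩ (_∈ˡ flat ps))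
    cover _          (z , there (there u∈))  = inj₂ (z , u∈)
    cover (inj₁ x∉Z) (z , here refl)         = contradiction z x∉Z
    cover (inj₂ _)   (z , here refl)         = inj₁ refl
    cover (inj₁ _)   (z , there (here refl)) = inj₁ refl
    cover (inj₂ y∉Z) (z , there (here refl)) = contradiction z y∉Z

-- Arithmetic

-- Linear arithmetic by certificate: a ≤ b sums the hypotheses and x + b + s ≡ y + a is a
-- ring identity.
≤-by-certificate : ∀ {x y a b} s → a ≤ b → x + b + s ≡ y + a → x ≤ y
≤-by-certificate {x} {y} {a} {b} s a≤b eq = +-cancelʳ-≤ a x y (begin
  x + a      ≤⟨ +-monoʳ-≤ x a≤b ⟩
  x + b      ≤⟨ m≤m+n (x + b) s ⟩
  x + b + s  ≡⟨ eq ⟩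
  y + a      ∎)
  where open ≤-Reasoning

positive-rest : ∀ {i k r} → k ≤ i + r → i < k → 0 < r
positive-rest {i} {r = zero}  k≤i+0 i<k = contradiction (≤-trans i<k (≤-trans k≤i+0 (≤-reflexive (+-identityʳ i)))) (n≮n i)
positive-rest {r = suc _} _ _ = s≤s z≤n

two≤n : ∀ {n t k} → 0 < k → 12 * t * k + 2 * k ≤ n → 2 ≤ n
two≤n {n} {t} {k} 0<k n-large = ≤-trans (*-monoʳ-≤ 2 0<k) (≤-trans (m≤n+m (2 * k) (12 * t * k)) n-large)

module _ (m t : ℕ) where

  private
    2≤2n : 2 ≤ 2 * suc m
    2≤2n = *-monoʳ-≤ 2 (s≤s z≤n)

  order+2 : 2 * suc m + t ∸ 2 + 2 ≡ 2 * suc m + t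
  order+2 = m∸n+n≡m (≤-trans 2≤2n (m≤m+n _ t))

  order-positive : 0 < t → 0 < 2 * suc m + t ∸ 2
  order-positive 0<t = m+n≤o⇒m≤o∸n 1 (+-mono-≤ 2≤2n 0<t)

below-order : ∀ {M} m t₀ → M < 2 * suc m + suc t₀ ∸ 2 → M ≤ t₀ + 2 * m
below-order {M} m t₀ M< = ≤-pred (begin-strict
  M                           <⟨ M< ⟩
  2 * suc m + suc t₀ ∸ 2      ≡⟨ cong (_∸ 2) (regroup m t₀) ⟩
  suc (t₀ + 2 * m) + 2 ∸ 2    ≡⟨ m+n∸n≡m (suc (t₀ + 2 * m)) 2 ⟩
  suc (t₀ + 2 * m)            ∎)
  where
  open ≤-Reasoning
  regroup : ∀ m t₀ → 2 * suc m + suc t₀ ≡ suc (t₀ + 2 * m) + 2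
  regroup = solve-∀

blueDegree-bound : ∀ {N n t r b} → N + 2 ≡ 2 * n + t → r + 2 ≤ n → suc (r + b) ≡ N → n + t ≤ suc b
blueDegree-bound {N} {n} {t} {r} {b} N+2 r+2≤n degrees = ≤-by-certificate 0 r+2≤n (begin
  n + t + n + 0      ≡⟨ rearrange n t ⟩
  2 * n + t          ≡⟨ N+2 ⟨
  N + 2              ≡⟨ cong (_+ 2) degrees ⟨
  suc (r + b) + 2    ≡⟨ rearrange′ r b ⟩
  suc b + (r + 2)    ∎)
  where
  open ≡-Reasoning
  rearrange : ∀ n t → n + t + n + 0 ≡ 2 * n + t
  rearrange = solve-∀
  rearrange′ : ∀ r b → suc (r + b) + 2 ≡ suc b + (r + 2)
  rearrange′ = solve-∀

clique-below-n : ∀ {n o s r} → o + s ≤ suc r → r + 2 ≤ n → suc s ≤ n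
clique-below-n {n} {o} {s} {r} clique small = ≤-by-certificate o (+-mono-≤ clique small) (identity n o s r)
  where
  identity : ∀ n o s r → suc s + (suc r + n) + o ≡ n + (o + s + (r + 2))
  identity = solve-∀

outside-clique : ∀ {n o s r β} → o + s ≤ suc r → r + 2 ≤ n → s + β + 1 ≡ n → o ≤ β
outside-clique {n} {o} {s} {r} {β} clique small size =
  ≤-by-certificate 0 (+-mono-≤ clique (+-mono-≤ small (≤-reflexive (sym size)))) (identity n o s r β)
  where
  identity : ∀ n o s r β → o + (suc r + (n + (s + β + 1))) + 0 ≡ β + (o + s + (r + 2 + n))
  identity = solve-∀

greedy-clique-bound : ∀ {n t k s} → n + t + 2 ≤ s + t * suc (2 * k) → n + 2 ≤ s + 2 * (t * k)
greedy-clique-bound {n} {t} {k} {s} h = ≤-by-certificate 0 h (identity n t k s)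
  where
  identity : ∀ n t k s → n + 2 + (s + t * suc (2 * k)) + 0 ≡ s + 2 * (t * k) + (n + t + 2)
  identity = solve-∀

clique-positive : ∀ {n t k s} → n + 2 ≤ s + 2 * (t * k) → 12 * t * k + 2 * k ≤ n → 0 < s
clique-positive {n} {t} {k} {s} large n-large = ≤-by-certificate (10 * t * k + 2 * k + 1) (+-mono-≤ large n-large) (identity n t k s)
  where
  identity : ∀ n t k s → 1 + (s + 2 * (t * k) + n) + (10 * t * k + 2 * k + 1) ≡ s + (n + 2 + (12 * t * k + 2 * k))
  identity = solve-∀

clique-slack : ∀ {n t k s β} → s + β + 1 ≡ n → n + 2 ≤ s + 2 * (t * k) → β + 3 ≤ 2 * (t * k)
clique-slack {n} {t} {k} {s} {β} size large = ≤-by-certificate 0 (+-mono-≤ large (≤-reflexive size)) (identity n t k s β)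
  where
  identity : ∀ n t k s β → β + 3 + (s + 2 * (t * k) + n) + 0 ≡ 2 * (t * k) + (n + 2 + (s + β + 1))
  identity = solve-∀

room-for-fans : ∀ {N n t k} → N + 2 ≡ 2 * n + t → 0 < k → 12 * t * k + 2 * k ≤ n → t * suc (2 * k) ≤ N
room-for-fans {N} {n} {t} {k} N+2 0<k n-large =
  ≤-by-certificate (22 * t * k + 2 * k) (+-mono-≤ (≤-reflexive (sym N+2)) (+-mono-≤ (*-monoʳ-≤ 2 n-large) (*-monoʳ-≤ 2 0<k)))
                   (identity N n t k)
  where
  identity : ∀ N n t k → t * suc (2 * k) + (N + 2 + (2 * n + 2 * k)) + (22 * t * k + 2 * k)
                         ≡ N + (2 * n + t + (2 * (12 * t * k + 2 * k) + 2 * 1))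
  identity = solve-∀

room-in-clique : ∀ {n t k s} → n + 2 ≤ s + 2 * (t * k) → 0 < k → 12 * t * k + 2 * k ≤ n → t * suc (2 * k) ≤ s
room-in-clique {n} {t} {k} {s} large 0<k n-large =
  ≤-by-certificate (7 * t * k + 2 * k + 2) (+-mono-≤ large (+-mono-≤ n-large (*-monoʳ-≤ t 0<k))) (identity n t k s)
  where
  identity : ∀ n t k s → t * suc (2 * k) + (s + 2 * (t * k) + (n + t * k)) + (7 * t * k + 2 * k + 2)
                         ≡ s + (n + 2 + (12 * t * k + 2 * k + t * 1))
  identity = solve-∀

clique-large : ∀ {n t k β} → β + 3 ≤ 2 * (t * k) → 0 < k → 4 * t * k * k ≤ n → (β + t) * k < n
clique-large {n} {t} {k} {β} β-small 0<k n-large =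
  ≤-by-certificate (t * k * k + 2 * k)
    (+-mono-≤ (*-monoˡ-≤ k β-small) (+-mono-≤ (*-monoʳ-≤ (t * k) 0<k) (+-mono-≤ 0<k n-large)))
    (identity n t k β)
  where
  identity : ∀ n t k β → suc ((β + t) * k) + (2 * (t * k) * k + (t * k * k + (k + n))) + (t * k * k + 2 * k)
                         ≡ n + ((β + 3) * k + (t * k * 1 + (1 + 4 * t * k * k)))
  identity = solve-∀

remainder-size : ∀ {N n t s₁ s₂ β γ c} → c + s₁ + s₂ ≡ N → N + 2 ≡ 2 * n + t → s₁ + β + 1 ≡ n → s₂ + γ + 1 ≡ n →
               c ≡ t + β + γ
remainder-size {N} {n} {t} {s₁} {s₂} {β} {γ} {c} total N+2 size₁ size₂ = +-cancelʳ-≡ (s₁ + s₂ + 2) c (t + β + γ) (begin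
  c + (s₁ + s₂ + 2)                    ≡⟨ regroup c s₁ s₂ ⟩
  c + s₁ + s₂ + 2                      ≡⟨ cong (_+ 2) total ⟩
  N + 2                                ≡⟨ N+2 ⟩
  2 * n + t                            ≡⟨ double n t ⟩
  n + n + t                            ≡⟨ cong₂ (λ a b → a + b + t) size₁ size₂ ⟨
  (s₁ + β + 1) + (s₂ + γ + 1) + t      ≡⟨ regroup′ s₁ s₂ β γ t ⟩
  t + β + γ + (s₁ + s₂ + 2)            ∎)
  where
  open ≡-Reasoning
  regroup : ∀ c s₁ s₂ → c + (s₁ + s₂ + 2) ≡ c + s₁ + s₂ + 2
  regroup = solve-∀
  double : ∀ n t → 2 * n + t ≡ n + n + t
  double = solve-∀
  regroup′ : ∀ s₁ s₂ β γ t → (s₁ + β + 1) + (s₂ + γ + 1) + t ≡ t + β + γ + (s₁ + s₂ + 2)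
  regroup′ = solve-∀

light⇒heavy : ∀ {n t k β γ a b} → n ≤ a + b + β + γ → b < β + t * k → β + 3 ≤ 2 * (t * k) → γ + 3 ≤ 2 * (t * k) →
              12 * t * k + 2 * k ≤ n → γ + t * k ≤ a
light⇒heavy {n} {t} {k} {β} {γ} {a} {b} degree few β-small γ-small n-large =
  ≤-by-certificate (2 * t * k + 2 * k + 13)
    (+-mono-≤ degree (+-mono-≤ few (+-mono-≤ (*-monoʳ-≤ 2 β-small) (+-mono-≤ (*-monoʳ-≤ 2 γ-small) n-large))))
    (identity n t k β γ a b)
  where
  identity : ∀ n t k β γ a b →
             γ + t * k + (a + b + β + γ + (β + t * k + (2 * (2 * (t * k)) + (2 * (2 * (t * k)) + n)))) + (2 * t * k + 2 * k + 13)
             ≡ a + (n + (suc b + (2 * (β + 3) + (2 * (γ + 3) + (12 * t * k + 2 * k)))))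
  identity = solve-∀

quota : ∀ t β γ a b → a + b ≡ t + β + γ → ∃₂ λ p p′ → p + p′ ≡ t × p ≤ a ∸ β × p′ ≤ b ∸ γ
quota t β γ a b sum with t + β ≤? a
... | yes t+β≤a = t , 0 , +-identityʳ t , m+n≤o⇒m≤o∸n t t+β≤a , z≤n
... | no  a≮t+β = p , t ∸ p , m+[n∸m]≡n p≤t , ≤-refl , m+n≤o⇒m≤o∸n (t ∸ p) (+-cancelˡ-≤ a _ _ (begin
  a + (t ∸ p + γ)              ≤⟨ +-monoˡ-≤ _ (m≤n+m∸n a β) ⟩
  β + p + (t ∸ p + γ)          ≡⟨ regroup β p (t ∸ p) γ ⟩
  p + (t ∸ p) + β + γ          ≡⟨ cong (λ s → s + β + γ) (m+[n∸m]≡n p≤t) ⟩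
  t + β + γ                    ≡⟨ sum ⟨
  a + b                        ∎))
  where
  open ≤-Reasoning
  p : ℕ
  p = a ∸ β
  p≤t : p ≤ t
  p≤t = m≤n+o⇒m∸n≤o a β (≤-trans (<⇒≤ (≰⇒> a≮t+β)) (≤-reflexive (+-comm t β)))
  regroup : ∀ β p q γ → β + p + (q + γ) ≡ p + q + β + γ
  regroup = solve-∀

-- The extremal colouring

module _ (t₀ m : ℕ) where

  Part : Set
  Part = Fin t₀ ⊎ (Fin 2 × Fin m)

  sameSide : Part → Part → Colour
  sameSide (inj₂ (s , _)) (inj₂ (s′ , _)) = does (s ≟ s′)
  sameSide _              _               = false

  sameSide-sym : ∀ p q → sameSide p q ≡ sameSide q p
  sameSide-sym (inj₁ _)       (inj₁ _)        = refl
  sameSide-sym (inj₁ _)       (inj₂ _)        = refl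
  sameSide-sym (inj₂ _)       (inj₁ _)        = refl
  sameSide-sym (inj₂ (s , _)) (inj₂ (s′ , _)) with s ≟ s′ | s′ ≟ s
  ... | yes _ | yes _ = refl
  ... | no  _ | no  _ = refl
  ... | yes p | no ¬q = contradiction (sym p) ¬q
  ... | no ¬p | yes q = contradiction (sym q) ¬p

  sameSide-inj₂ : ∀ {p q} → sameSide p q ≡ true → ∃₂ λ s a → p ≡ inj₂ (s , a)
  sameSide-inj₂ {inj₂ (s , a)} {inj₂ _} _ = s , a , refl

  sameSide-side : ∀ {s a q} → sameSide (inj₂ (s , a)) q ≡ true → ∃ λ b → q ≡ inj₂ (s , b)
  sameSide-side {s} {q = inj₂ (s′ , b)} red with s ≟ s′
  ... | yes refl = b , refl

  Apex : Part → Set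
  Apex p = ∃ λ a → p ≡ inj₁ a

  blueTriangle-apex : ∀ p q r → sameSide p q ≡ false → sameSide p r ≡ false → sameSide q r ≡ false →
                      Apex p ⊎ Apex q ⊎ Apex r
  blueTriangle-apex (inj₁ a) _        _        _ _ _ = inj₁ (a , refl)
  blueTriangle-apex (inj₂ _) (inj₁ b) _        _ _ _ = inj₂ (inj₁ (b , refl))
  blueTriangle-apex (inj₂ _) (inj₂ _) (inj₁ c) _ _ _ = inj₂ (inj₂ (c , refl))
  blueTriangle-apex (inj₂ (zero , _))       (inj₂ (zero , _))       (inj₂ _)                () _  _
  blueTriangle-apex (inj₂ (suc zero , _))   (inj₂ (suc zero , _))   (inj₂ _)                () _  _
  blueTriangle-apex (inj₂ (zero , _))       (inj₂ (suc zero , _))   (inj₂ (zero , _))       _  () _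
  blueTriangle-apex (inj₂ (zero , _))       (inj₂ (suc zero , _))   (inj₂ (suc zero , _))   _  _  ()
  blueTriangle-apex (inj₂ (suc zero , _))   (inj₂ (zero , _))       (inj₂ (zero , _))       _  _  ()
  blueTriangle-apex (inj₂ (suc zero , _))   (inj₂ (zero , _))       (inj₂ (suc zero , _))   _  () _

  module _ {M : ℕ} (M≤ : M ≤ t₀ + 2 * m) where

    part : Fin M → Part
    part i = Sum.map₂ (remQuot m) (splitAt t₀ (inject≤ i M≤))

    part-injective : Injective _≡_ _≡_ part
    part-injective {i} {j} eq = inject≤-injective M≤ M≤ i j (splitAt-injective (map₂-remQuot-injective eq))
      where
      splitAt-injective : ∀ {x y} → splitAt t₀ x ≡ splitAt t₀ y → x ≡ y
      splitAt-injective {x} {y} e = trans (sym (join-splitAt t₀ (2 * m) x)) (trans (cong (join t₀ (2 * m)) e) (join-splitAt t₀ (2 * m) y))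
      map₂-remQuot-injective : ∀ {x y} → Sum.map₂ (remQuot m) x ≡ Sum.map₂ (remQuot m) y → x ≡ y
      map₂-remQuot-injective {inj₁ _} {inj₁ _} refl = refl
      map₂-remQuot-injective {inj₂ x} {inj₂ y} e =
        cong inj₂ (trans (sym (combine-remQuot m x)) (trans (cong (uncurry combine) (inj₂-injective e)) (combine-remQuot m y)))

    extremalColouring : Colouring M
    extremalColouring = record { col = λ i j → sameSide (part i) (part j) ; symm = λ i j → sameSide-sym (part i) (part j) }

    noRedStar : 0 < m → ¬ HasMono extremalColouring red (Star (suc m))
    noRedStar 0<m (f , f-injective , red-edges) = n≮n m (injective⇒≤ key-injective)
      where
      leaf : Fin (suc m)
      leaf = suc (fromℕ< 0<m)
      centre-in-side : ∃₂ λ s a → part (f zero) ≡ inj₂ (s , a)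
      centre-in-side = sameSide-inj₂ (red-edges zero leaf (inj₁ (refl , λ ())))
      s : Fin 2
      s = proj₁ centre-in-side
      on-side : ∀ j → ∃ λ b → part (f j) ≡ inj₂ (s , b)
      on-side zero    = proj₂ centre-in-side
      on-side (suc j) = sameSide-side (subst (λ p → sameSide p (part (f (suc j))) ≡ true)
                                             (proj₂ (proj₂ centre-in-side)) (red-edges zero (suc j) (inj₁ (refl , λ ()))))
      key : Fin (suc m) → Fin m
      key j = proj₁ (on-side j)
      key-injective : Injective _≡_ _≡_ key
      key-injective {i} {j} e = f-injective (part-injective
        (trans (proj₂ (on-side i)) (trans (cong (λ b → inj₂ (s , b)) e) (sym (proj₂ (on-side j))))))

    noBlueFans : ∀ {k} → 0 < k → ¬ HasMono extremalColouring blue (tFan (suc t₀) k)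
    noBlueFans {k} 0<k (f , f-injective , blue-edges) = n≮n t₀ (injective⇒≤ apex-injective)
      where
      1<2k+1 : 1 < suc (2 * k)
      1<2k+1 = s≤s (≤-trans 0<k (m≤m+n k (k + 0)))
      2<2k+1 : 2 < suc (2 * k)
      2<2k+1 = s≤s (*-monoʳ-≤ 2 0<k)
      v₁ v₂ : Fin (suc (2 * k))
      v₁ = fromℕ< 1<2k+1
      v₂ = fromℕ< 2<2k+1
      blue-at : ∀ i {x y} → FanAdj (toℕ x) (toℕ y) → sameSide (part (f (i , x))) (part (f (i , y))) ≡ false
      blue-at i adj = blue-edges (i , _) (i , _) (refl , adj)
      triangle-apex : ∀ i → ∃ λ x → Apex (part (f (i , x)))
      triangle-apex i with blueTriangle-apex (part (f (i , zero))) (part (f (i , v₁))) (part (f (i , v₂)))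
                             (blue-at i (subst (FanAdj 0) (sym (toℕ-fromℕ< 1<2k+1)) (inj₁ (refl , λ ()))))
                             (blue-at i (subst (FanAdj 0) (sym (toℕ-fromℕ< 2<2k+1)) (inj₁ (refl , λ ()))))
                             (blue-at i (subst₂ FanAdj (sym (toℕ-fromℕ< 1<2k+1)) (sym (toℕ-fromℕ< 2<2k+1))
                                                (inj₂ (inj₂ ((λ ()) , (λ ()) , (λ ()) , refl)))))
      ... | inj₁ apex        = zero , apex
      ... | inj₂ (inj₁ apex) = v₁ , apex
      ... | inj₂ (inj₂ apex) = v₂ , apex
      apex : Fin (suc t₀) → Fin t₀
      apex i = proj₁ (proj₂ (triangle-apex i))
      apex-injective : Injective _≡_ _≡_ apex
      apex-injective {i} {j} e = cong proj₁ (f-injective (part-injective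
        (trans (proj₂ (proj₂ (triangle-apex i))) (trans (cong inj₁ e) (sym (proj₂ (proj₂ (triangle-apex j))))))))

    lowerBound : ∀ {k} → 0 < m → 0 < k → ¬ Arrows (Star (suc m)) (tFan (suc t₀) k) M
    lowerBound 0<m 0<k arrows with arrows extremalColouring
    ... | inj₁ redStar  = noRedStar 0<m redStar
    ... | inj₂ blueFans = noBlueFans 0<k blueFans

-- Degrees, red stars and blue fans

≢red⇒blue : ∀ {b} → b ≢ red → b ≡ blue
≢red⇒blue {false} _  = refl
≢red⇒blue {true}  ¬r = contradiction refl ¬r

≢blue⇒red : ∀ {b} → b ≢ blue → b ≡ red
≢blue⇒red {true}  _  = refl
≢blue⇒red {false} ¬b = contradiction refl ¬b

module _ {N : ℕ} (c : Colouring N) where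

  open import Data.List.Membership.DecPropositional (_≟_ {N}) using () renaming (_∈?_ to _∈ˡ?_)

  Blue : Fin N → Fin N → Set
  Blue x y = col c x y ≡ blue

  Blue-sym : ∀ {x y} → Blue x y → Blue y x
  Blue-sym {x} {y} b = trans (symm c y x) b

  BlueNbr : Fin N → Pred (Fin N) 0ℓ
  BlueNbr v u = u ≢ v × Blue v u

  BlueNbr? : ∀ v → Decidable (BlueNbr v)
  BlueNbr? v u = ¬? (u ≟ v) ×-dec (col c v u ≟ᵇ blue)

  blueDegree : Fin N → ℕ
  blueDegree v = count (BlueNbr? v)

  RedNbr : Fin N → Pred (Fin N) 0ℓ
  RedNbr v u = u ≢ v × col c v u ≡ red

  RedNbr? : ∀ v → Decidable (RedNbr v)
  RedNbr? v u = ¬? (u ≟ v) ×-dec (col c v u ≟ᵇ red)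

  redDegree : Fin N → ℕ
  redDegree v = count (RedNbr? v)

  degree-sum : ∀ v → suc (redDegree v + blueDegree v) ≡ N
  degree-sum v = begin
    suc (redDegree v + blueDegree v)                          ≡⟨ cong suc (cong₂ _+_ (count-cong _ _ red≐) (count-cong _ _ blue≐)) ⟩
    suc (count (Others? ∩? Red?) + count (Others? ∖? Red?))    ≡⟨ cong suc (count-split Others? Red?) ⟨
    suc (count Others?)                                       ≡⟨ count-remove (U? {A = Fin N}) {v} tt ⟨
    count (U? {A = Fin N})                                    ≡⟨ count-U ⟩
    N                                                         ∎
    where
    open ≡-Reasoning
    Others? : Decidable (U ∖ (_≡ v))
    Others? = U? ∖? (_≟ v)
    Red? : Decidable (λ u → col c v u ≡ red)
    Red? u = col c v u ≟ᵇ red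
    red≐ : RedNbr v ≐ (U ∖ (_≡ v)) ∩ (λ u → col c v u ≡ red)
    red≐ = (λ (u≢v , r) → (tt , u≢v) , r) , λ ((_ , u≢v) , r) → u≢v , r
    blue≐ : BlueNbr v ≐ (U ∖ (_≡ v)) ∖ (λ u → col c v u ≡ red)
    blue≐ = (λ (u≢v , b) → (tt , u≢v) , λ r → contradiction (trans (sym b) r) λ ())
          , λ ((_ , u≢v) , ¬r) → u≢v , ≢red⇒blue ¬r

  redStar : ∀ {v m} → m ≤ redDegree v → HasMono c red (Star (suc m))
  redStar {v} {m} many = centre-and-leaves , injective , red-edges
    where
    leaves : m ↪ RedNbr v
    leaves = pickDistinct (RedNbr? v) m many
    centre-and-leaves : Fin (suc m) → Fin N
    centre-and-leaves zero    = v
    centre-and-leaves (suc i) = elem leaves i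
    injective : Injective _≡_ _≡_ centre-and-leaves
    injective {zero}  {zero}  _ = refl
    injective {zero}  {suc j} e = contradiction (sym e) (proj₁ (elem∈ leaves j))
    injective {suc i} {zero}  e = contradiction e (proj₁ (elem∈ leaves i))
    injective {suc i} {suc j} e = cong suc (elem-injective leaves e)
    red-edges : ∀ a b → Adj (Star (suc m)) a b → col c (centre-and-leaves a) (centre-and-leaves b) ≡ red
    red-edges zero    (suc j) _ = proj₂ (elem∈ leaves j)
    red-edges (suc i) zero    _ = trans (symm c _ v) (proj₂ (elem∈ leaves i))
    red-edges zero    zero    (inj₁ (_ , 0≢0)) = contradiction refl 0≢0
    red-edges zero    zero    (inj₂ (_ , 0≢0)) = contradiction refl 0≢0
    red-edges (suc _) (suc _) (inj₁ (() , _))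
    red-edges (suc _) (suc _) (inj₂ (() , _))

  record Matching (P : Pred (Fin N) 0ℓ) (k : ℕ) : Set where
    field
      edges    : Vec (Fin N × Fin N) k
      allBlue  : Allᵛ.All (λ (x , y) → Blue x y) edges
      inside   : Allˡ.All P (flat edges)
      distinct : Unique (flat edges)
  open Matching public

  Matching-mono : ∀ {P Q : Pred (Fin N) 0ℓ} {k} → P ⊆ Q → Matching P k → Matching Q k
  Matching-mono P⊆Q M = record { edges = edges M ; allBlue = allBlue M ; inside = Allˡ.map P⊆Q (inside M) ; distinct = distinct M }

  record Fan (k : ℕ) : Set where
    constructor fan
    field
      centre : Fin N
      blades : Matching (BlueNbr centre) k
  open Fan public

  vertices : ∀ {k} → Fan k → List (Fin N)
  vertices F = centre F ∷ flat (edges (blades F))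

  data Fans (k : ℕ) : ℕ → Set
  used : ∀ {k m} → Fans k m → List (Fin N)

  data Fans k where
    []    : Fans k 0
    _∷_⊣_ : ∀ {m} (F : Fan k) (Fs : Fans k m) → (∀ {u} → u ∈ˡ vertices F → u ∉ˡ used Fs) → Fans k (suc m)

  used []           = []
  used (F ∷ Fs ⊣ _) = vertices F ++ used Fs

  -- Vertex 0 of a fan is its centre and vertices 2i + 1, 2i + 2 are the ends of blade i,
  -- matching the numbering of FanAdj.
  vertexAt : ∀ {k} → Fan k → ℕ → Fin N
  vertexAt F = nth (centre F) (vertices F)

  index<length : ∀ {k} (F : Fan k) (j : Fin (suc (2 * k))) → toℕ j < length (vertices F)
  index<length F j = subst (toℕ j <_) (sym (cong suc (length-flat (edges (blades F))))) (toℕ<n j)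

  vertexAt-∈ : ∀ {k} (F : Fan k) (j : Fin (suc (2 * k))) → vertexAt F (toℕ j) ∈ˡ vertices F
  vertexAt-∈ F j = nth-∈ (centre F) (vertices F) (index<length F j)

  vertices-unique : ∀ {k} (F : Fan k) → Unique (vertices F)
  vertices-unique F = Allˡ.map (λ (u≢c , _) c≡u → u≢c (sym c≡u)) (inside (blades F)) ∷ distinct (blades F)

  centre-blue : ∀ {k} (F : Fan k) {b} → b < 2 * k → Blue (centre F) (vertexAt F (suc b))
  centre-blue F {b} b< = proj₂ (Allˡ.lookup (inside (blades F)) (nth-∈ (centre F) (flat (edges (blades F)))
    (subst (b <_) (sym (length-flat (edges (blades F)))) b<)))

  fan-blue : ∀ {k} (F : Fan k) {a b} → a < suc (2 * k) → b < suc (2 * k) → FanAdj a b → Blue (vertexAt F a) (vertexAt F b)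
  fan-blue F {zero}  {suc b} _ (s≤s b<) (inj₁ _) = centre-blue F b<
  fan-blue F {suc a} {zero}  (s≤s a<) _ (inj₂ (inj₁ _)) = Blue-sym (centre-blue F a<)
  fan-blue F {suc a} {suc b} (s≤s a<) (s≤s b<) (inj₂ (inj₂ (_ , _ , a≢b , e))) =
    nth-flat-pair Blue Blue-sym (edges (blades F)) (allBlue (blades F)) (centre F) a< b< (λ a≡b → a≢b (cong suc a≡b)) e
  fan-blue F {zero}  {zero}  _ _ (inj₁ (_ , b≢0)) = contradiction refl b≢0
  fan-blue F {zero}  {zero}  _ _ (inj₂ (inj₁ (_ , a≢0))) = contradiction refl a≢0
  fan-blue F {zero}  {_}     _ _ (inj₂ (inj₂ (a≢0 , _))) = contradiction refl a≢0
  fan-blue F {_}     {zero}  _ _ (inj₂ (inj₂ (_ , b≢0 , _))) = contradiction refl b≢0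

  fanAt : ∀ {k m} → Fans k m → Fin m → Fan k
  fanAt (F ∷ _  ⊣ _) zero    = F
  fanAt (_ ∷ Fs ⊣ _) (suc i) = fanAt Fs i

  fanAt-used : ∀ {k m} (Fs : Fans k m) i {u} → u ∈ˡ vertices (fanAt Fs i) → u ∈ˡ used Fs
  fanAt-used (F ∷ Fs ⊣ _) zero    u∈ = ∈-++⁺ˡ u∈
  fanAt-used (F ∷ Fs ⊣ _) (suc i) u∈ = ∈-++⁺ʳ (vertices F) (fanAt-used Fs i u∈)

  embedding : ∀ {k m} → Fans k m → Fin m × Fin (suc (2 * k)) → Fin N
  embedding Fs (i , j) = vertexAt (fanAt Fs i) (toℕ j)

  embedding-injective : ∀ {k m} (Fs : Fans k m) → Injective _≡_ _≡_ (embedding Fs)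
  embedding-injective (F ∷ Fs ⊣ fresh) {zero , j} {zero , j′} e =
    cong (zero ,_) (toℕ-injective (nth-injective (centre F) (vertices-unique F) (index<length F j) (index<length F j′) e))
  embedding-injective (F ∷ Fs ⊣ fresh) {zero , j} {suc i′ , j′} e =
    contradiction (subst (_∈ˡ used Fs) (sym e) (fanAt-used Fs i′ (vertexAt-∈ (fanAt Fs i′) j′))) (fresh (vertexAt-∈ F j))
  embedding-injective (F ∷ Fs ⊣ fresh) {suc i , j} {zero , j′} e =
    contradiction (subst (_∈ˡ used Fs) e (fanAt-used Fs i (vertexAt-∈ (fanAt Fs i) j))) (fresh (vertexAt-∈ F j′))
  embedding-injective (F ∷ Fs ⊣ fresh) {suc i , j} {suc i′ , j′} e =
    cong (λ (i , j) → suc i , j) (embedding-injective Fs {i , j} {i′ , j′} e)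

  fans⇒blue-tFan : ∀ {k t} → Fans k t → HasMono c blue (tFan t k)
  fans⇒blue-tFan {k} {t} Fs = embedding Fs , embedding-injective Fs , blue-edges
    where
    blue-edges : ∀ u v → Adj (tFan t k) u v → Blue (embedding Fs u) (embedding Fs v)
    blue-edges (i , a) (.i , b) (refl , adj) = fan-blue (fanAt Fs i) (toℕ<n a) (toℕ<n b) adj

  -- Greedy constructions

  RedClique : Pred (Fin N) 0ℓ → Set
  RedClique Q = ∀ {x y} → x ∈ Q → y ∈ Q → x ≢ y → col c x y ≡ red

  record RedCliqueIn (P : Pred (Fin N) 0ℓ) : Set₁ where
    field
      members  : Pred (Fin N) 0ℓ
      members? : Decidable members
      ⊆P       : members ⊆ P
      isRed    : RedClique members
    size : ℕ
    size = count members?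
  open RedCliqueIn public

  RedCliqueIn-mono : ∀ {P Q : Pred (Fin N) 0ℓ} → P ⊆ Q → RedCliqueIn P → RedCliqueIn Q
  RedCliqueIn-mono P⊆Q K = record { members = members K ; members? = members? K ; ⊆P = P⊆Q ∘ ⊆P K ; isRed = isRed K }

  BlueEdgeIn : Pred (Fin N) 0ℓ → Set
  BlueEdgeIn R = ∃ λ x → ∃ λ y → x ∈ R × y ∈ R × x ≢ y × Blue x y

  blueEdgeIn? : ∀ {R} → Decidable R → Dec (BlueEdgeIn R)
  blueEdgeIn? R? = any? λ x → any? λ y → R? x ×-dec R? y ×-dec ¬? (x ≟ y) ×-dec (col c x y ≟ᵇ blue)

  noBlueEdge⇒redClique : ∀ {R} → ¬ BlueEdgeIn R → RedClique R
  noBlueEdge⇒redClique {R} none {x} {y} x∈R y∈R x≢y with col c x y in eq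
  ... | true  = refl
  ... | false = contradiction (x , y , x∈R , y∈R , x≢y , eq) none

  module _ {P : Pred (Fin N) 0ℓ} where

    noMatching : Matching P 0
    noMatching = record { edges = [] ; allBlue = Allᵛ.[] ; inside = Allˡ.[] ; distinct = [] }

    extendMatching : ∀ {i} (M : Matching P i) → BlueEdgeIn (P ∖ (_∈ˡ flat (edges M))) → Matching P (suc i)
    extendMatching M (x , y , (x∈P , x∉M) , (y∈P , y∉M) , x≢y , xy-blue) = record
      { edges    = (x , y) ∷ edges M
      ; allBlue  = xy-blue Allᵛ.∷ allBlue M
      ; inside   = x∈P Allˡ.∷ y∈P Allˡ.∷ inside M
      ; distinct = (x≢y Allˡ.∷ ¬Any⇒All¬ _ x∉M) ∷ ¬Any⇒All¬ _ y∉M ∷ distinct M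
      }

    greedyMatching : (P? : Decidable P) → ∀ k → Matching P k ⊎ Σ (RedCliqueIn P) λ K → count P? + 2 ≤ size K + 2 * k
    greedyMatching P? k = grow k ≤-refl
      where
      grow : ∀ i → i ≤ k → Matching P i ⊎ Σ (RedCliqueIn P) λ K → count P? + 2 ≤ size K + 2 * k
      grow zero    _   = inj₁ noMatching
      grow (suc i) i<k with grow i (≤-trans (n≤1+n i) i<k)
      ... | inj₂ K = inj₂ K
      ... | inj₁ M with blueEdgeIn? (P? ∖? (_∈ˡ? flat (edges M)))
      ... | yes e    = inj₁ (extendMatching M e)
      ... | no  none = inj₂ (record { members = P ∖ (_∈ˡ flat (edges M)) ; members? = P? ∖? (_∈ˡ? flat (edges M))
                                    ; ⊆P = proj₁ ; isRed = noBlueEdge⇒redClique none } , large)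
        where
        open ≤-Reasoning
        R? : Decidable (P ∖ (_∈ˡ flat (edges M)))
        R? = P? ∖? (_∈ˡ? flat (edges M))
        large : count P? + 2 ≤ count R? + 2 * k
        large = begin
          count P? + 2            ≤⟨ +-monoˡ-≤ 2 (count-∖ P? (_∈ˡ? flat (edges M)) used≤2i) ⟩
          2 * i + count R? + 2    ≡⟨ shuffle i (count R?) ⟩
          count R? + 2 * suc i    ≤⟨ +-monoʳ-≤ (count R?) (*-monoʳ-≤ 2 i<k) ⟩
          count R? + 2 * k        ∎
          where
          shuffle : ∀ i r → 2 * i + r + 2 ≡ r + 2 * suc i
          shuffle = solve-∀
          used≤2i : count (P? ∩? (_∈ˡ? flat (edges M))) ≤ 2 * i
          used≤2i = ≤-trans (count-mono _ (_∈ˡ? flat (edges M)) proj₂)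
                            (≤-trans (count-∈ (flat (edges M))) (≤-reflexive (length-flat (edges M))))

  length-used : ∀ {k m} (Fs : Fans k m) → length (used Fs) ≡ m * suc (2 * k)
  length-used []           = refl
  length-used (F ∷ Fs ⊣ _) = trans (length-++ (vertices F)) (cong₂ _+_ (cong suc (length-flat (edges (blades F)))) (length-used Fs))

  count-used : ∀ {k m} {P : Pred (Fin N) 0ℓ} (P? : Decidable P) (Fs : Fans k m) →
               count P? ≤ m * suc (2 * k) + count (P? ∖? (_∈ˡ? used Fs))
  count-used {k} {m} P? Fs = begin
    count P?                                    ≤⟨ count-∖ P? Used? (count-mono (P? ∩? Used?) Used? proj₂) ⟩
    count Used? + count (P? ∖? Used?)           ≤⟨ +-monoˡ-≤ (count (P? ∖? Used?)) (count-∈ (used Fs)) ⟩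
    length (used Fs) + count (P? ∖? Used?)      ≡⟨ cong (_+ count (P? ∖? Used?)) (length-used Fs) ⟩
    m * suc (2 * k) + count (P? ∖? Used?)       ∎
    where
    open ≤-Reasoning
    Used? : Decidable (_∈ˡ used Fs)
    Used? = _∈ˡ? used Fs

  greedyFans : ∀ {S : Pred (Fin N) 0ℓ} (S? : Decidable S) k t D →
               (∀ v → D ≤ suc (blueDegree v)) → t * suc (2 * k) ≤ count S? →
               Fans k t ⊎ ∃ λ v → v ∈ S × Σ (RedCliqueIn (BlueNbr v)) λ K → D + 2 ≤ size K + t * suc (2 * k)
  greedyFans {S} S? k t D deg room = grow t ≤-refl
    where
    Result : Set₁
    Result = ∃ λ v → v ∈ S × Σ (RedCliqueIn (BlueNbr v)) λ K → D + 2 ≤ size K + t * suc (2 * k)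
    grow : ∀ j → j ≤ t → Fans k j ⊎ Result
    grow zero    _   = inj₁ []
    grow (suc j) j<t with grow j (≤-trans (n≤1+n j) j<t)
    ... | inj₂ K  = inj₂ K
    ... | inj₁ Fs with count>0⇒nonempty (S? ∖? (_∈ˡ? used Fs)) centre-available
      where
      centre-available : 0 < count (S? ∖? (_∈ˡ? used Fs))
      centre-available = +-cancelˡ-< (j * suc (2 * k)) 0 _ (begin-strict
        j * suc (2 * k) + 0                             ≡⟨ +-identityʳ _ ⟩
        j * suc (2 * k)                                 <⟨ *-monoˡ-< (suc (2 * k)) j<t ⟩
        t * suc (2 * k)                                 ≤⟨ room ⟩
        count S?                                        ≤⟨ count-used S? Fs ⟩
        j * suc (2 * k) + count (S? ∖? (_∈ˡ? used Fs))   ∎)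
        where open ≤-Reasoning
    ... | v , v∈S , v∉used with greedyMatching (BlueNbr? v ∖? (_∈ˡ? used Fs)) k
    ... | inj₁ M = inj₁ (fan v (Matching-mono proj₁ M) ∷ Fs ⊣ fresh)
      where
      fresh : ∀ {u} → u ∈ˡ (v ∷ flat (edges M)) → u ∉ˡ used Fs
      fresh (here refl) = v∉used
      fresh (there u∈M) = proj₂ (Allˡ.lookup (inside M) u∈M)
    ... | inj₂ (K , large) = inj₂ (v , v∈S , RedCliqueIn-mono proj₁ K , bound)
      where
      open ≤-Reasoning
      P? : Decidable (BlueNbr v ∖ (_∈ˡ used Fs))
      P? = BlueNbr? v ∖? (_∈ˡ? used Fs)
      regroup : ∀ a p → suc (a + p) + 2 ≡ a + 1 + (p + 2)
      regroup = solve-∀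
      shuffle : ∀ j s k → j * suc (2 * k) + 1 + (s + 2 * k) ≡ s + suc j * suc (2 * k)
      shuffle = solve-∀
      bound : D + 2 ≤ size K + t * suc (2 * k)
      bound = begin
        D + 2                                           ≤⟨ +-monoˡ-≤ 2 (≤-trans (deg v) (s≤s (count-used (BlueNbr? v) Fs))) ⟩
        suc (j * suc (2 * k) + count P?) + 2            ≡⟨ regroup (j * suc (2 * k)) (count P?) ⟩
        j * suc (2 * k) + 1 + (count P? + 2)            ≤⟨ +-monoʳ-≤ (j * suc (2 * k) + 1) large ⟩
        j * suc (2 * k) + 1 + (size K + 2 * k)          ≡⟨ shuffle j (size K) k ⟩
        size K + suc j * suc (2 * k)                    ≤⟨ +-monoʳ-≤ (size K) (*-monoˡ-≤ (suc (2 * k)) j<t) ⟩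
        size K + t * suc (2 * k)                        ∎

  cliqueMember-redDegree : ∀ {Q : Pred (Fin N) 0ℓ} (Q? : Decidable Q) → RedClique Q → ∀ {x} → x ∈ Q →
                           count (RedNbr? x ∖? Q?) + count Q? ≤ suc (redDegree x)
  cliqueMember-redDegree {Q} Q? red {x} x∈Q = begin
    count (RedNbr? x ∖? Q?) + count Q?                       ≡⟨ cong (count (RedNbr? x ∖? Q?) +_) (count-remove Q? x∈Q) ⟩
    count (RedNbr? x ∖? Q?) + suc (count (Q? ∖? (_≟ x)))    ≤⟨ +-monoʳ-≤ _ (s≤s (count-mono _ (RedNbr? x ∩? Q?) inClique)) ⟩
    count (RedNbr? x ∖? Q?) + suc (count (RedNbr? x ∩? Q?))  ≡⟨ +-suc _ _ ⟩
    suc (count (RedNbr? x ∖? Q?) + count (RedNbr? x ∩? Q?))  ≡⟨ cong suc (+-comm (count (RedNbr? x ∖? Q?)) _) ⟩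
    suc (count (RedNbr? x ∩? Q?) + count (RedNbr? x ∖? Q?))  ≡⟨ cong suc (count-split (RedNbr? x) Q?) ⟨
    suc (redDegree x)                                        ∎
    where
    open ≤-Reasoning
    inClique : Q ∖ (_≡ x) ⊆ RedNbr x ∩ Q
    inClique (u∈Q , u≢x) = (u≢x , red x∈Q u∈Q (λ x≡u → u≢x (sym x≡u))) , u∈Q

  -- Fans between two red cliques

  -- Fans centred in Cs whose blades join X to Y.  A vertex of X has at most δ red neighbours
  -- outside X, so it is blue to one of any δ + 1 free centres; X-large then forces one of them
  -- to see k free vertices of X.  A centre sees δ + tk vertices of Y, which is enough to
  -- finish each blade after discarding the red neighbours of its X-end and the used vertices.
  module Phase (k t δ : ℕ) {X Y Cs : Pred (Fin N) 0ℓ} (X? : Decidable X) (Y? : Decidable Y) (Cs? : Decidable Cs)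
               (disjointXY : ∀ {u} → u ∈ X → u ∉ Y) (disjointCX : ∀ {u} → u ∈ Cs → u ∉ X) (disjointCY : ∀ {u} → u ∈ Cs → u ∉ Y)
               (X-redOutside : ∀ {x} → x ∈ X → count (RedNbr? x ∖? X?) ≤ δ)
               (Cs-blueToY : ∀ {v} → v ∈ Cs → δ + t * k ≤ count (Y? ∩? BlueNbr? v))
               (X-large : (δ + t) * k < count X? + suc δ) where

    record Blades (v : Fin N) (U : List (Fin N)) (i : ℕ) : Set where
      field
        matching : Matching (BlueNbr v ∖ (_∈ˡ U)) i
        acrossXY : Allᵛ.All (λ (x , y) → x ∈ X × y ∈ Y) (edges matching)
    open Blades

    notX : ∀ {u} → u ∈ Y → u ∉ X
    notX u∈Y u∈X = disjointXY u∈X u∈Y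

    module _ {v W i} (S : Blades v W i) where

      bladeVertices : List (Fin N)
      bladeVertices = flat (edges (matching S))

      FreshX : Pred (Fin N) 0ℓ
      FreshX = ((X ∖ (_∈ˡ W)) ∩ BlueNbr v) ∖ (_∈ˡ bladeVertices)

      FreshY : Fin N → Pred (Fin N) 0ℓ
      FreshY x = (((Y ∩ BlueNbr v) ∖ RedNbr x) ∖ (_∈ˡ W)) ∖ (_∈ˡ bladeVertices)

      X∩blades≤i : count (X? ∩? (_∈ˡ? bladeVertices)) ≤ i
      X∩blades≤i = count-∩-flat X? (edges (matching S)) (Allᵛ.map (λ (_ , y∈Y) → inj₂ (notX y∈Y)) (acrossXY S))

      Y∩blades≤i : count (Y? ∩? (_∈ˡ? bladeVertices)) ≤ i
      Y∩blades≤i = count-∩-flat Y? (edges (matching S)) (Allᵛ.map (λ (x∈X , _) → inj₁ (disjointXY x∈X)) (acrossXY S))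

      freshX : i < k → k ≤ count ((X? ∖? (_∈ˡ? W)) ∩? BlueNbr? v) → ∃ FreshX
      freshX i<k X-room = count>0⇒nonempty (A? ∖? M?) (positive-rest (≤-trans X-room (count-∖ A? M? in-blades)) i<k)
        where
        M? : Decidable (_∈ˡ bladeVertices)
        M? = _∈ˡ? bladeVertices
        A? : Decidable ((X ∖ (_∈ˡ W)) ∩ BlueNbr v)
        A? = (X? ∖? (_∈ˡ? W)) ∩? BlueNbr? v
        in-blades : count (A? ∩? M?) ≤ i
        in-blades = ≤-trans (count-mono _ (X? ∩? M?) λ (((x∈X , _) , _) , u∈) → x∈X , u∈) X∩blades≤i

      freshY : i < k → v ∈ Cs → count (Y? ∩? (_∈ˡ? W)) + k ≤ t * k → ∀ {x} → x ∈ X → ∃ (FreshY x)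
      freshY i<k v∈Cs Y-room {x} x∈X = count>0⇒nonempty (B? ∖? M?)
        (positive-rest (+-cancelˡ-≤ (count (Y? ∩? W?)) _ _ (≤-trans Y-room (+-cancelˡ-≤ δ _ _ blue-in-Y))) i<k)
        where
        open ≤-Reasoning
        M? : Decidable (_∈ˡ bladeVertices)
        M? = _∈ˡ? bladeVertices
        W? : Decidable (_∈ˡ W)
        W? = _∈ˡ? W
        B? : Decidable (((Y ∩ BlueNbr v) ∖ RedNbr x) ∖ (_∈ˡ W))
        B? = ((Y? ∩? BlueNbr? v) ∖? RedNbr? x) ∖? W?
        red-to-x : count ((Y? ∩? BlueNbr? v) ∩? RedNbr? x) ≤ δ
        red-to-x = ≤-trans (count-mono _ (RedNbr? x ∖? X?) λ ((y∈Y , _) , red) → red , notX y∈Y) (X-redOutside x∈X)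
        in-W : count (((Y? ∩? BlueNbr? v) ∖? RedNbr? x) ∩? W?) ≤ count (Y? ∩? W?)
        in-W = count-mono _ (Y? ∩? W?) λ (((y∈Y , _) , _) , u∈W) → y∈Y , u∈W
        in-blades : count (B? ∩? M?) ≤ i
        in-blades = ≤-trans (count-mono _ (Y? ∩? M?) λ ((((y∈Y , _) , _) , _) , u∈) → y∈Y , u∈) Y∩blades≤i
        blue-in-Y : δ + t * k ≤ δ + (count (Y? ∩? W?) + (i + count (B? ∖? M?)))
        blue-in-Y = begin
          δ + t * k                                        ≤⟨ Cs-blueToY v∈Cs ⟩
          count (Y? ∩? BlueNbr? v)                         ≤⟨ count-∖ _ (RedNbr? x) red-to-x ⟩
          δ + count ((Y? ∩? BlueNbr? v) ∖? RedNbr? x)      ≤⟨ +-monoʳ-≤ δ (count-∖ _ W? in-W) ⟩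
          δ + (count (Y? ∩? W?) + count B?)                ≤⟨ +-monoʳ-≤ δ (+-monoʳ-≤ (count (Y? ∩? W?)) (count-∖ B? M? in-blades)) ⟩
          δ + (count (Y? ∩? W?) + (i + count (B? ∖? M?)))  ∎

      blade-ends : ∀ {u} → u ∈ˡ bladeVertices → u ∈ X ⊎ u ∈ Y
      blade-ends = ends (edges (matching S)) (acrossXY S)
        where
        ends : ∀ {i} (ps : Vec (Fin N × Fin N) i) → Allᵛ.All (λ (x , y) → x ∈ X × y ∈ Y) ps → ∀ {u} → u ∈ˡ flat ps → u ∈ X ⊎ u ∈ Y
        ends (_ ∷ _)  ((x∈X , _) Allᵛ.∷ _)  (here refl)         = inj₁ x∈X
        ends (_ ∷ _)  ((_ , y∈Y) Allᵛ.∷ _)  (there (here refl)) = inj₂ y∈Y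
        ends (_ ∷ ps) (_ Allᵛ.∷ across)     (there (there u∈))  = ends ps across u∈

      extendBlades : ∀ {x y} → x ∈ FreshX → y ∈ FreshY x → Blades v W (suc i)
      extendBlades {x} {y} (((x∈X , x∉W) , x-blue) , x∉S) ((((y∈Y , y-blue) , y-notRed) , y∉W) , y∉S) = record
        { matching = extendMatching (matching S) (x , y , ((x-blue , x∉W) , x∉S) , ((y-blue , y∉W) , y∉S) , x≢y , xy-blue)
        ; acrossXY = (x∈X , y∈Y) Allᵛ.∷ acrossXY S
        }
        where
        x≢y : x ≢ y
        x≢y x≡y = disjointXY x∈X (subst (_∈ Y) (sym x≡y) y∈Y)
        xy-blue : Blue x y
        xy-blue = ≢red⇒blue λ red → y-notRed ((λ y≡x → x≢y (sym y≡x)) , red)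

    buildBlades : ∀ {v W} → v ∈ Cs → count (Y? ∩? (_∈ˡ? W)) + k ≤ t * k → k ≤ count ((X? ∖? (_∈ˡ? W)) ∩? BlueNbr? v) → Blades v W k
    buildBlades {v} {W} v∈Cs Y-room X-room = grow k ≤-refl
      where
      grow : ∀ i → i ≤ k → Blades v W i
      grow zero    _   = record { matching = noMatching ; acrossXY = Allᵛ.[] }
      grow (suc i) i<k = extend (freshX S i<k X-room)
        where
        S : Blades v W i
        S = grow i (≤-trans (n≤1+n i) i<k)
        extend : ∃ (FreshX S) → Blades v W (suc i)
        extend (x , x-fresh@(((x∈X , _) , _) , _)) = extendBlades S x-fresh (proj₂ (freshY S i<k v∈Cs Y-room x∈X))

    blueToSomeCentre : ∀ {P : Pred (Fin N) 0ℓ} (Z : suc δ ↪ P) → P ⊆ Cs → ∀ {x} → x ∈ X → ∃ λ i → elem Z i ∈ BlueNbr x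
    blueToSomeCentre Z P⊆Cs {x} x∈X with any? (λ i → BlueNbr? x (elem Z i))
    ... | yes someBlue = someBlue
    ... | no  noneBlue = contradiction (↪⇒≤count (RedNbr? x ∖? X?) allRed) (<⇒≱ (s≤s (X-redOutside x∈X)))
      where
      allRed : suc δ ↪ (RedNbr x ∖ X)
      allRed = record
        { elem           = elem Z
        ; elem-injective = elem-injective Z
        ; elem∈          = λ i → let z∉X = disjointCX (P⊆Cs (elem∈ Z i))
                                     z≢x = λ z≡x → z∉X (subst (_∈ X) (sym z≡x) x∈X)
                                 in (z≢x , ≢blue⇒red λ blue → noneBlue (i , z≢x , blue)) , z∉X
        }

    centreWithRoom : ∀ W → count (X? ∩? (_∈ˡ? W)) + k ≤ t * k → suc δ ≤ count (Cs? ∖? (_∈ˡ? W)) →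
                     ∃ λ v → v ∈ Cs ∖ (_∈ˡ W) × k ≤ count ((X? ∖? (_∈ˡ? W)) ∩? BlueNbr? v)
    centreWithRoom W X-room Cs-room = choose (any? λ i → k ≤? count (A? (elem Z i)))
      where
      W? : Decidable (_∈ˡ W)
      W? = _∈ˡ? W
      Z : suc δ ↪ (Cs ∖ (_∈ˡ W))
      Z = pickDistinct (Cs? ∖? W?) (suc δ) Cs-room
      A : Fin N → Pred (Fin N) 0ℓ
      A z = (X ∖ (_∈ˡ W)) ∩ BlueNbr z
      A? : ∀ z → Decidable (A z)
      A? z = (X? ∖? W?) ∩? BlueNbr? z
      choose : Dec (∃ λ i → k ≤ count (A? (elem Z i))) → ∃ λ v → v ∈ Cs ∖ (_∈ˡ W) × k ≤ count (A? v)
      choose (yes (i , many)) = elem Z i , elem∈ Z i , many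
      choose (no none) = contradiction X-large (≤⇒≯ (+-cancelʳ-≤ k _ _ (begin
        count X? + suc δ + k                              ≤⟨ +-monoˡ-≤ k (+-monoˡ-≤ (suc δ) (count-∖ X? W? ≤-refl)) ⟩
        count (X? ∩? W?) + count (X? ∖? W?) + suc δ + k   ≤⟨ +-monoˡ-≤ k (+-monoˡ-≤ (suc δ) (+-monoʳ-≤ _ (count-mono _ ⋃A? covered))) ⟩
        count (X? ∩? W?) + count ⋃A? + suc δ + k          ≡⟨ regroup (count (X? ∩? W?)) (count ⋃A?) (suc δ) k ⟩
        (count (X? ∩? W?) + k) + (count ⋃A? + suc δ)      ≤⟨ +-mono-≤ X-room (count-⋃ (A? ∘ elem Z) small) ⟩
        t * k + suc δ * k                                 ≡⟨ distrib t δ k ⟩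
        (δ + t) * k + k                                   ∎)))
        where
        open ≤-Reasoning
        ⋃A? : Decidable (⋃ (Fin (suc δ)) (A ∘ elem Z))
        ⋃A? x = any? λ i → A? (elem Z i) x
        small : ∀ i → count (A? (elem Z i)) < k
        small i = ≰⇒> λ many → none (i , many)
        covered : X ∖ (_∈ˡ W) ⊆ ⋃ (Fin (suc δ)) (A ∘ elem Z)
        covered x-free@(x∈X , _) =
          let (i , (z≢x , blue)) = blueToSomeCentre Z proj₁ x∈X
          in i , x-free , (λ x≡z → z≢x (sym x≡z)) , trans (symm c _ _) blue
        regroup : ∀ a b v d → a + b + v + d ≡ (a + d) + (b + v)
        regroup = solve-∀
        distrib : ∀ t δ k → t * k + suc δ * k ≡ (δ + t) * k + k
        distrib = solve-∀

    record Progress (U₀ : List (Fin N)) (m j : ℕ) : Set where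
      field
        fans    : Fans k m
        X-used  : count (X? ∩? (_∈ˡ? used fans)) ≤ m * k
        Y-used  : count (Y? ∩? (_∈ˡ? used fans)) ≤ m * k
        Cs-used : count (Cs? ∩? (_∈ˡ? used fans)) ≤ j
        -- lets the second phase check that the first used none of its centres
        new⊆    : ∀ {u} → u ∈ˡ used fans → u ∈ˡ U₀ ⊎ u ∈ X ∪ Y ∪ Cs
    open Progress public

    module _ {v W} (v∈Cs : v ∈ Cs) (S : Blades v W k) where

      bladeFan : Fan k
      bladeFan = fan v (Matching-mono proj₁ (matching S))

      bladeFan⊆ : ∀ {u} → u ∈ˡ vertices bladeFan → u ∈ X ∪ Y ∪ Cs
      bladeFan⊆ (here refl) = inj₂ (inj₂ v∈Cs)
      bladeFan⊆ (there u∈) with blade-ends S u∈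
      ... | inj₁ u∈X = inj₁ u∈X
      ... | inj₂ u∈Y = inj₂ (inj₁ u∈Y)

      X∩bladeFan≤k : count (X? ∩? (_∈ˡ? vertices bladeFan)) ≤ k
      X∩bladeFan≤k = ≤-trans (count-mono _ (X? ∩? (_∈ˡ? bladeVertices S)) dropCentre) (X∩blades≤i S)
        where
        dropCentre : X ∩ (_∈ˡ vertices bladeFan) ⊆ X ∩ (_∈ˡ bladeVertices S)
        dropCentre (u∈X , here refl) = contradiction u∈X (disjointCX v∈Cs)
        dropCentre (u∈X , there u∈)  = u∈X , u∈

      Y∩bladeFan≤k : count (Y? ∩? (_∈ˡ? vertices bladeFan)) ≤ k
      Y∩bladeFan≤k = ≤-trans (count-mono _ (Y? ∩? (_∈ˡ? bladeVertices S)) dropCentre) (Y∩blades≤i S)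
        where
        dropCentre : Y ∩ (_∈ˡ vertices bladeFan) ⊆ Y ∩ (_∈ˡ bladeVertices S)
        dropCentre (u∈Y , here refl) = contradiction u∈Y (disjointCY v∈Cs)
        dropCentre (u∈Y , there u∈)  = u∈Y , u∈

      Cs∩bladeFan≤1 : count (Cs? ∩? (_∈ˡ? vertices bladeFan)) ≤ 1
      Cs∩bladeFan≤1 = ≤-trans (count-mono _ (_≟ v) onlyCentre) (≤-reflexive (count-≡ v))
        where
        onlyCentre : Cs ∩ (_∈ˡ vertices bladeFan) ⊆ (_≡ v)
        onlyCentre (_    , here refl) = refl
        onlyCentre (u∈Cs , there u∈) with blade-ends S u∈
        ... | inj₁ u∈X = contradiction u∈X (disjointCX u∈Cs)
        ... | inj₂ u∈Y = contradiction u∈Y (disjointCY u∈Cs)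

    extendProgress : ∀ {U₀ m j v} (s : Progress U₀ m j) → v ∈ Cs → v ∉ˡ used (fans s) → Blades v (used (fans s)) k →
                     Progress U₀ (suc m) (suc j)
    extendProgress {U₀} s v∈Cs v∉W S = record
      { fans    = F ∷ fans s ⊣ fresh
      ; X-used  = ≤-trans (count-∩-++ X? (vertices F) W) (+-mono-≤ (X∩bladeFan≤k v∈Cs S) (X-used s))
      ; Y-used  = ≤-trans (count-∩-++ Y? (vertices F) W) (+-mono-≤ (Y∩bladeFan≤k v∈Cs S) (Y-used s))
      ; Cs-used = ≤-trans (count-∩-++ Cs? (vertices F) W) (+-mono-≤ (Cs∩bladeFan≤1 v∈Cs S) (Cs-used s))
      ; new⊆    = new⊆′
      }
      where
      W : List (Fin N)
      W = used (fans s)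
      F : Fan k
      F = bladeFan v∈Cs S
      fresh : ∀ {u} → u ∈ˡ vertices F → u ∉ˡ W
      fresh (here refl) = v∉W
      fresh (there u∈)  = proj₂ (Allˡ.lookup (inside (matching S)) u∈)
      new⊆′ : ∀ {u} → u ∈ˡ used (F ∷ fans s ⊣ fresh) → u ∈ˡ U₀ ⊎ u ∈ X ∪ Y ∪ Cs
      new⊆′ u∈ with ∈-++⁻ (vertices F) u∈
      ... | inj₁ u∈F = inj₂ (bladeFan⊆ v∈Cs S u∈F)
      ... | inj₂ u∈W = new⊆ s u∈W

    addFan : ∀ {U₀ m j} → Progress U₀ m j → suc m ≤ t → suc j + δ ≤ count Cs? → Progress U₀ (suc m) (suc j)
    addFan {U₀} {m} {j} s m<t Cs-room = extend (centreWithRoom W (room (X-used s)) centres-left)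
      where
      W : List (Fin N)
      W = used (fans s)
      room : ∀ {a} → a ≤ m * k → a + k ≤ t * k
      room {a} a≤mk = ≤-trans (≤-reflexive (+-comm a k)) (≤-trans (+-monoʳ-≤ k a≤mk) (*-monoˡ-≤ k m<t))
      centres-left : suc δ ≤ count (Cs? ∖? (_∈ˡ? W))
      centres-left = +-cancelˡ-≤ j _ _ (≤-trans (≤-reflexive (+-suc j δ)) (≤-trans Cs-room (count-∖ Cs? (_∈ˡ? W) (Cs-used s))))
      extend : (∃ λ v → v ∈ Cs ∖ (_∈ˡ W) × k ≤ count ((X? ∖? (_∈ˡ? W)) ∩? BlueNbr? v)) → Progress U₀ (suc m) (suc j)
      extend (v , (v∈Cs , v∉W) , many) = extendProgress s v∈Cs v∉W (buildBlades v∈Cs (room (Y-used s)) many)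

    addFans : ∀ {U₀ m₀} q → q + m₀ ≤ t → q ≤ count Cs? ∸ δ → Progress U₀ m₀ 0 → Progress U₀ (q + m₀) q
    addFans zero    _    _     s = s
    addFans (suc q) room quota s =
      addFan (addFans q (≤-trans (n≤1+n _) room) (≤-trans (n≤1+n q) quota) s) room (≤∸⇒+≤ quota)
      where
      ≤∸⇒+≤ : ∀ {a b} → suc a ≤ b ∸ δ → suc a + δ ≤ b
      ≤∸⇒+≤ {a} {b} h with ≤-total δ b
      ... | inj₁ δ≤b = ≤-trans (+-monoˡ-≤ δ h) (≤-reflexive (m∸n+n≡m δ≤b))
      ... | inj₂ b≤δ = contradiction (≤-trans h (≤-reflexive (m≤n⇒m∸n≡0 b≤δ))) λ ()

  -- The upper bound

  module SmallRedDegrees (n t k : ℕ) (N+2 : N + 2 ≡ 2 * n + t) (0<k : 0 < k)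
                    (n-large : 12 * t * k + 2 * k ≤ n) (n-large² : 4 * t * k * k ≤ n)
                    (redDegree-small : ∀ v → redDegree v + 2 ≤ n) where

    blueDegree-large : ∀ v → n + t ≤ suc (blueDegree v)
    blueDegree-large v = blueDegree-bound N+2 (redDegree-small v) (degree-sum v)

    Large : ∀ {P} → RedCliqueIn P → Set
    Large K = n + 2 ≤ size K + 2 * (t * k)

    record Shape {P} (K : RedCliqueIn P) : Set where
      field
        slack        : ℕ
        size+slack   : size K + slack + 1 ≡ n
        slack-small  : slack + 3 ≤ 2 * (t * k)
        redOutside   : ∀ {x} → x ∈ members K → count (RedNbr? x ∖? members? K) ≤ slack

    shape : ∀ {P} (K : RedCliqueIn P) → Large K → Shape K
    shape K large = record
      { slack       = β
      ; size+slack  = size+β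
      ; slack-small = clique-slack {t = t} {k = k} size+β large
      ; redOutside  = λ x∈K → outside-clique (cliqueMember-redDegree (members? K) (isRed K) x∈K) (redDegree-small _) size+β
      }
      where
      member : ∃ (members K)
      member = count>0⇒nonempty (members? K) (clique-positive {t = t} {k = k} large n-large)
      below : suc (size K) ≤ n
      below = clique-below-n (cliqueMember-redDegree (members? K) (isRed K) (proj₂ member)) (redDegree-small (proj₁ member))
      β : ℕ
      β = proj₁ (m≤n⇒∃[o]m+o≡n below)
      size+β : size K + β + 1 ≡ n
      size+β = trans (+-comm (size K + β) 1) (proj₂ (m≤n⇒∃[o]m+o≡n below))

    module TwoCliques {P Q} (I : RedCliqueIn P) (J : RedCliqueIn Q) (disjoint : ∀ {u} → u ∈ members I → u ∉ members J)
                      (I-shape : Shape I) (J-shape : Shape J) where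

      open Shape I-shape renaming (slack to β; size+slack to I-size; slack-small to β-small; redOutside to I-redOutside)
      open Shape J-shape renaming (slack to γ; size+slack to J-size; slack-small to γ-small; redOutside to J-redOutside)

      I? : Decidable (members I)
      I? = members? I
      J? : Decidable (members J)
      J? = members? J

      C : Pred (Fin N) 0ℓ
      C = (U ∖ members I) ∖ members J

      C? : Decidable C
      C? = (U? ∖? I?) ∖? J?

      C-size : count C? ≡ t + β + γ
      C-size = remainder-size total N+2 I-size J-size
        where
        J≐ : ((U ∖ members I) ∩ members J) ≐ members J
        J≐ = proj₂ , λ u∈J → (tt , λ u∈I → disjoint u∈I u∈J) , u∈J
        I≐ : (U ∩ members I) ≐ members I
        I≐ = proj₂ , λ u∈I → tt , u∈I
        total : count C? + size I + size J ≡ N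
        total = begin
          count C? + size I + size J                                  ≡⟨ regroup (count C?) (size I) (size J) ⟩
          size I + (size J + count C?)                                ≡⟨ cong₂ (λ a b → a + (b + count C?)) (count-cong _ _ I≐) (count-cong _ _ J≐) ⟨
          count (U? ∩? I?) + (count ((U? ∖? I?) ∩? J?) + count C?)     ≡⟨ cong (count (U? ∩? I?) +_) (count-split (U? ∖? I?) J?) ⟨
          count (U? ∩? I?) + count (U? ∖? I?)                          ≡⟨ count-split U? I? ⟨
          count (U? {A = Fin N})                                      ≡⟨ count-U ⟩
          N                                                           ∎
          where
          open ≡-Reasoning
          regroup : ∀ c i j → c + i + j ≡ i + (j + c)
          regroup = solve-∀

      blueIn : ∀ {K : Pred (Fin N) 0ℓ} → Decidable K → Fin N → ℕ
      blueIn K? v = count (K? ∩? BlueNbr? v)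

      C-blueDegree : ∀ {v} → v ∈ C → n ≤ blueIn I? v + blueIn J? v + β + γ
      C-blueDegree {v} v∈C = +-cancelʳ-≤ t n _ (begin
        n + t                                              ≤⟨ blueDegree-large v ⟩
        suc (blueDegree v)                                 ≤⟨ s≤s (count-mono (BlueNbr? v) (I-part ∪? (J-part ∪? Others?)) split) ⟩
        suc (count (I-part ∪? (J-part ∪? Others?)))        ≤⟨ s≤s (≤-trans (count-∪ I-part _) (+-monoʳ-≤ _ (count-∪ J-part Others?))) ⟩
        suc (blueIn I? v + (blueIn J? v + count Others?))  ≡⟨ regroup (blueIn I? v) (blueIn J? v) (count Others?) ⟩
        blueIn I? v + blueIn J? v + suc (count Others?)    ≡⟨ cong (blueIn I? v + blueIn J? v +_) (count-remove C? v∈C) ⟨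
        blueIn I? v + blueIn J? v + count C?               ≡⟨ cong (blueIn I? v + blueIn J? v +_) C-size ⟩
        blueIn I? v + blueIn J? v + (t + β + γ)            ≡⟨ regroup′ (blueIn I? v) (blueIn J? v) t β γ ⟩
        blueIn I? v + blueIn J? v + β + γ + t              ∎)
        where
        open ≤-Reasoning
        I-part : Decidable (members I ∩ BlueNbr v)
        I-part = I? ∩? BlueNbr? v
        J-part : Decidable (members J ∩ BlueNbr v)
        J-part = J? ∩? BlueNbr? v
        Others? : Decidable (C ∖ (_≡ v))
        Others? = C? ∖? (_≟ v)
        split : BlueNbr v ⊆ (members I ∩ BlueNbr v) ∪ ((members J ∩ BlueNbr v) ∪ (C ∖ (_≡ v)))
        split {u} u∈B with I? u | J? u
        ... | yes u∈I | _       = inj₁ (u∈I , u∈B)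
        ... | no  _   | yes u∈J = inj₂ (inj₁ (u∈J , u∈B))
        ... | no  u∉I | no  u∉J = inj₂ (inj₂ (((tt , u∉I) , u∉J) , proj₁ u∈B))
        regroup : ∀ a b o → suc (a + (b + o)) ≡ a + b + suc o
        regroup = solve-∀
        regroup′ : ∀ a b t β γ → a + b + (t + β + γ) ≡ a + b + β + γ + t
        regroup′ = solve-∀

      X-large-from-slack : ∀ {s δ} → s + δ + 1 ≡ n → δ + 3 ≤ 2 * (t * k) → (δ + t) * k < s + suc δ
      X-large-from-slack {s} {δ} size small = ≤-trans (clique-large {t = t} small 0<k n-large²)
                                                     (≤-reflexive (trans (sym size) (trans (+-assoc s δ 1) (cong (s +_) (+-comm δ 1)))))

      -- A vertex of C has n - β - γ blue neighbours in I ∪ J (C-blueDegree), so it has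
      -- β + tk of them in J or, by light⇒heavy, γ + tk in I.
      Blue-J-heavy : Fin N → Set
      Blue-J-heavy v = β + t * k ≤ blueIn J? v

      CI CJ : Pred (Fin N) 0ℓ
      CI = C ∩ Blue-J-heavy
      CJ = C ∖ Blue-J-heavy

      CI? : Decidable CI
      CI? = C? ∩? λ v → β + t * k ≤? blueIn J? v
      CJ? : Decidable CJ
      CJ? = C? ∖? λ v → β + t * k ≤? blueIn J? v

      CJ-blueToI : ∀ {v} → v ∈ CJ → γ + t * k ≤ blueIn I? v
      CJ-blueToI (v∈C , light) = light⇒heavy {t = t} {k = k} (C-blueDegree v∈C) (≰⇒> light) β-small γ-small n-large

      module Phase₁ = Phase k t β I? J? CI?
                            disjoint (λ v∈CI → proj₂ (proj₁ (proj₁ v∈CI))) (λ v∈CI → proj₂ (proj₁ v∈CI))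
                            I-redOutside proj₂ (X-large-from-slack I-size β-small)
      module Phase₂ = Phase k t γ J? I? CJ?
                            (λ u∈J u∈I → disjoint u∈I u∈J) (λ v∈CJ → proj₂ (proj₁ v∈CJ)) (λ v∈CJ → proj₂ (proj₁ (proj₁ v∈CJ)))
                            J-redOutside CJ-blueToI (X-large-from-slack J-size γ-small)

      fans : Fans k t
      fans = run (quota t β γ (count CI?) (count CJ?) (trans (sym (count-split C? Blue-J-heavy?)) C-size))
        where
        Blue-J-heavy? : Decidable Blue-J-heavy
        Blue-J-heavy? v = β + t * k ≤? blueIn J? v
        run : (∃₂ λ p p′ → p + p′ ≡ t × p ≤ count CI? ∸ β × p′ ≤ count CJ? ∸ γ) → Fans k t
        run (p , p′ , p+p′≡t , p≤ , p′≤) = subst (Fans k) all-fans (Phase₂.fans second)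
          where
          first-room : p + 0 ≤ t
          first-room = ≤-trans (≤-reflexive (+-identityʳ p)) (≤-trans (m≤m+n p p′) (≤-reflexive p+p′≡t))
          all-fans : p′ + (p + 0) ≡ t
          all-fans = trans (cong (p′ +_) (+-identityʳ p)) (trans (+-comm p′ p) p+p′≡t)
          none : ∀ {Z : Pred (Fin N) 0ℓ} (Z? : Decidable Z) → count (Z? ∩? (_∈ˡ? [])) ≤ 0
          none Z? = ≤-reflexive (count-empty (Z? ∩? (_∈ˡ? [])) λ { (_ , ()) })
          first : Phase₁.Progress [] (p + 0) p
          first = Phase₁.addFans p first-room p≤
                    (record { fans = [] ; X-used = none I? ; Y-used = none J? ; Cs-used = none CI? ; new⊆ = λ () })
          untouched : ∀ {u} → u ∈ CJ → u ∉ˡ used (Phase₁.fans first)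
          untouched (((_ , u∉I) , u∉J) , light) u∈ with Phase₁.new⊆ first u∈
          ... | inj₁ ()
          ... | inj₂ (inj₁ u∈I)                = u∉I u∈I
          ... | inj₂ (inj₂ (inj₁ u∈J))         = u∉J u∈J
          ... | inj₂ (inj₂ (inj₂ (_ , heavy))) = light heavy
          second : Phase₂.Progress (used (Phase₁.fans first)) (p′ + (p + 0)) p′
          second = Phase₂.addFans p′ (≤-reflexive all-fans) p′≤
                     (record { fans    = Phase₁.fans first
                             ; X-used  = Phase₁.Y-used first
                             ; Y-used  = Phase₁.X-used first
                             ; Cs-used = ≤-reflexive (count-empty (CJ? ∩? (_∈ˡ? used (Phase₁.fans first))) λ (u∈CJ , u∈) → untouched u∈CJ u∈)
                             ; new⊆    = inj₁
                             })

    blueFans : Fans k t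
    blueFans = fromFirst (greedyFans U? k t (n + t) blueDegree-large room)
      where
      room : t * suc (2 * k) ≤ count (U? {A = Fin N})
      room = ≤-trans (room-for-fans N+2 0<k n-large) (≤-reflexive (sym count-U))
      Outcome : Pred (Fin N) 0ℓ → Set₁
      Outcome S = Fans k t ⊎ ∃ λ v → v ∈ S × Σ (RedCliqueIn (BlueNbr v)) λ K → n + t + 2 ≤ size K + t * suc (2 * k)
      fromSecond : ∀ {P} (I : RedCliqueIn P) → Large I → Outcome (members I) → Fans k t
      fromSecond I I-large (inj₁ Fs) = Fs
      fromSecond I I-large (inj₂ (x , x∈I , J , J-large)) =
        TwoCliques.fans I J disjoint (shape I I-large) (shape J (greedy-clique-bound {t = t} J-large))
        where
        disjoint : ∀ {u} → u ∈ members I → u ∉ members J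
        disjoint u∈I u∈J = let (u≢x , blue) = ⊆P J u∈J in
          contradiction (trans (sym blue) (isRed I x∈I u∈I (λ x≡u → u≢x (sym x≡u)))) λ ()
      fromFirst : Outcome U → Fans k t
      fromFirst (inj₁ Fs) = Fs
      fromFirst (inj₂ (_ , _ , I , I-bound)) =
        fromSecond I I-large (greedyFans (members? I) k t (n + t) blueDegree-large (room-in-clique {t = t} I-large 0<k n-large))
        where
        I-large : Large I
        I-large = greedy-clique-bound {t = t} I-bound

upperBound : ∀ {N} m t k → N + 2 ≡ 2 * suc m + t → 0 < k → 12 * t * k + 2 * k ≤ suc m → 4 * t * k * k ≤ suc m →
             Arrows (Star (suc m)) (tFan t k) N
upperBound m t k N+2 0<k n-large n-large² c with any? (λ v → m ≤? redDegree c v)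
... | yes (v , many) = inj₁ (redStar c many)
... | no  none       = inj₂ (fans⇒blue-tFan c (SmallRedDegrees.blueFans c (suc m) t k N+2 0<k n-large n-large² small))
  where
  small : ∀ v → redDegree c v + 2 ≤ suc m
  small v = ≤-trans (≤-reflexive (+-comm (redDegree c v) 2)) (s≤s (≰⇒> λ many → none (v , many)))

theorem1p6 : (k t n : ℕ) → 0 < k → 0 < t →
    (12 * t * k + 2 * k) ⊔ (4 * t * k * k) ≤ n →
    IsRamseyNumber (Star n) (tFan t k) (2 * n + t ∸ 2)
theorem1p6 k zero n _ () _
theorem1p6 k t@(suc _) zero 0<k _ n-large = contradiction (two≤n {t = t} 0<k (m⊔n≤o⇒m≤o (12 * t * k + 2 * k) _ n-large)) λ ()
theorem1p6 k (suc t₀) (suc m) 0<k 0<t n-large =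
    order-positive m (suc t₀) 0<t
  , upperBound m (suc t₀) k (order+2 m (suc t₀)) 0<k n-large₁ n-large₂
  , λ M _ M<N → lowerBound t₀ m (below-order m t₀ M<N) (≤-pred (two≤n {t = suc t₀} 0<k n-large₁)) 0<k
  where
  n-large₁ : 12 * suc t₀ * k + 2 * k ≤ suc m
  n-large₁ = m⊔n≤o⇒m≤o (12 * suc t₀ * k + 2 * k) (4 * suc t₀ * k * k) n-large
  n-large₂ : 4 * suc t₀ * k * k ≤ suc m
  n-large₂ = m⊔n≤o⇒n≤o (12 * suc t₀ * k + 2 * k) (4 * suc t₀ * k * k) n-large
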